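{- For set compositions $\Phi\models[n]$ and $\Psi\models[k]$, in $NCQSym^\ast$ one has $\mathbf{V}_\Phi\mathbf{V}_\Psi=\mathbf{V}_{\Phi|\Psi}$.
   Context: A set composition $\Phi\models[n]$ is a sequence $(\Phi_1,\dots,\Phi_\ell)$ of nonempty pairwise disjoint subsets of $[n]$ with union $[n]$; $\ell(\Phi)=\ell$ and $\alpha(\Phi)=(|\Phi_1|,\dots,|\Phi_\ell|)$. For $\Phi\models[n]$, $\Psi\models[k]$, $\Phi|\Psi=(\Phi_1,\dots,\Phi_{\ell(\Phi)},\Psi_1+n,\dots,\Psi_{\ell(\Psi)}+n)$. $\Phi$ is atomic if $n\ge1$ and $\Phi\ne\Psi|\Gamma$ for nonempty $\Psi,\Gamma$; every $\Phi$ factors uniquely as $\Phi=\Phi^{(1)}|\cdots|\Phi^{(d)}$ with each $\Phi^{(i)}$ atomic, and $\Phi^!=(\Phi^{(1)},\dots,\Phi^{(d)})$. For a sequence of disjoint nonempty finite sets of integers, $st$ replaces the entries by $1,2,\dots$ keeping their relative order. For an $n$-element set $S$, $\Phi\!\uparrow_S$ replaces entries via the order-preserving bijection $[n]\to S$; $\cdot$ denotes concatenation of sequences. $NCQSym^\ast$ is the $\mathbb{Q}$-algebra with basis $\{\mathbf{W}_\Phi:\Phi\models[n],n\ge0\}$ and product $\mathbf{W}_\Phi\mathbf{W}_\Psi=\sum_{S\in\binom{[n+k]}{n}}\mathbf{W}_{\Phi\uparrow_S\cdot\Psi\uparrow_{[n+k]\setminus S}}$ (this is the graded dual of $NCQSym$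 with $\mathbf{W}$ dual to the monomial basis $\mathbf{M}$). Define $\Phi\le_\#\Psi$ iff $\alpha(\Phi)=\alpha(\Psi)$ and, writing $\Phi^!=(\Phi^{(1)},\dots,\Phi^{(d)})$, $\ell_0=0$, $\ell_i=\ell(\Phi^{(1)})+\cdots+\ell(\Phi^{(i)})$, one has $\Phi^{(i)}=st(\Psi_{\ell_{i-1}+1},\dots,\Psi_{\ell_i})$ for all $i$. Define $\mathbf{V}_\Phi=\sum_{\Phi'\ge_\#\Phi}\mathbf{W}_{\Phi'}$. -}

module Defs where

open import Data.Nat using (ℕ; zero; suc; _+_; _∸_; _≤_; _<_; _≟_; _≤?_; _<?_)
open import Data.List using (List; []; _∷_; _++_; map; concat; concatMap; length; filter; upTo; take; drop; foldr)
open import Data.List.Properties using (≡-dec)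
open import Data.List.Relation.Unary.All using (All; all?)
open import Data.List.Relation.Unary.AllPairs using (AllPairs; allPairs?)
open import Data.List.Membership.Propositional using (_∈_; _∉_)
open import Data.List.Membership.DecPropositional _≟_ using (_∈?_)
open import Data.Product using (_×_; _,_)
open import Data.Rational using (ℚ; 0ℚ; 1ℚ) renaming (_+_ to _+ℚ_; _*_ to _*ℚ_)
open import Relation.Nullary using (Dec; yes; no; ¬_; ¬?)
open import Relation.Nullary.Decidable using (_×-dec_)
open import Relation.Binary.PropositionalEquality using (_≡_)

-- Finite sets of positive integers are represented by strictly
-- increasing lists; a (candidate) set composition is a list of blocks.

Block : Set
Block = List ℕ

SetComp : Set
SetComp = List Block

_≟B_ : (A B : Block) → Dec (A ≡ B)
_≟B_ = ≡-dec _≟_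

_≟SC_ : (Φ Ψ : SetComp) → Dec (Φ ≡ Ψ)
_≟SC_ = ≡-dec _≟B_

_≟α_ : (a b : List ℕ) → Dec (a ≡ b)
_≟α_ = ≡-dec _≟_

range : ℕ → List ℕ
range n = map suc (upTo n)

Disjoint : Block → Block → Set
Disjoint A B = All (λ x → x ∉ B) A

disjoint? : (A B : Block) → Dec (Disjoint A B)
disjoint? A B = all? (λ x → ¬? (x ∈? B)) A

IsSetComp : ℕ → SetComp → Set
IsSetComp n Φ =
  All (λ B → (0 < length B) × AllPairs _<_ B) Φ
  × AllPairs Disjoint Φ
  × All (λ x → x ∈ range n) (concat Φ)
  × All (λ x → x ∈ concat Φ) (range n)

isSetComp? : (n : ℕ) (Φ : SetComp) → Dec (IsSetComp n Φ)
isSetComp? n Φ =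
  all? (λ B → (0 <? length B) ×-dec allPairs? _<?_ B) Φ
  ×-dec allPairs? disjoint? Φ
  ×-dec all? (λ x → x ∈? range n) (concat Φ)
  ×-dec all? (λ x → x ∈? concat Φ) (range n)

sublists : List ℕ → List (List ℕ)
sublists []       = [] ∷ []
sublists (x ∷ xs) = map (x ∷_) (sublists xs) ++ sublists xs

words : {A : Set} → ℕ → List A → List (List A)
words zero    L = [] ∷ []
words (suc l) L = concatMap (λ x → map (x ∷_) (words l L)) L

-- a set composition of [n] has at most n blocks
allSetComps : ℕ → List SetComp
allSetComps n =
  filter (isSetComp? n)
    (concatMap (λ l → words l (sublists (range n))) (upTo (suc n)))

α : SetComp → List ℕ
α = map length

ℓ : SetComp → ℕ
ℓ = length

-- i-th element (0-based) of a list, default 0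
nth : List ℕ → ℕ → ℕ
nth []       _       = 0
nth (x ∷ xs) zero    = x
nth (x ∷ xs) (suc i) = nth xs i

_↑_ : SetComp → List ℕ → SetComp
Φ ↑ S = map (map (λ i → nth S (i ∸ 1))) Φ

st : SetComp → SetComp
st Φ = map (map (λ x → length (filter (λ y → y ≤? x) (concat Φ)))) Φ

bar : ℕ → SetComp → SetComp → SetComp
bar n Φ Ψ = Φ ++ map (map (n +_)) Ψ

-- Atomic factorization Φ^! = (Φ^(1),…,Φ^(d)).
-- Φ = Ψ|Γ with Ψ ⊨ [m], ℓ(Ψ) = j  iff the union of the first j blocks of Φ
-- is [m].  The atomic factors are obtained by cutting Φ at every j ≥ 1
-- where the union of the first j blocks is an initial segment [m].

ClosedPrefix : SetComp → ℕ → Set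
ClosedPrefix Φ j = All (λ x → x ∈ range (length (concat (take j Φ)))) (concat (take j Φ))

closedPrefix? : (Φ : SetComp) (j : ℕ) → Dec (ClosedPrefix Φ j)
closedPrefix? Φ j = all? (λ x → x ∈? range (length (concat (take j Φ)))) (concat (take j Φ))

cuts : SetComp → List ℕ
cuts Φ = filter (closedPrefix? Φ) (range (ℓ Φ))

diffs : ℕ → List ℕ → List ℕ
diffs prev []       = []
diffs prev (c ∷ cs) = (c ∸ prev) ∷ diffs c cs

chop : {A : Set} → List ℕ → List A → List (List A)
chop []       xs = []
chop (l ∷ ls) xs = take l xs ∷ chop ls (drop l xs)

atomicLengths : SetComp → List ℕ
atomicLengths Φ = diffs 0 (cuts Φ)

atomicFactors : SetComp → List SetComp
atomicFactors Φ = map st (chop (atomicLengths Φ) Φ)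

_≤#_ : SetComp → SetComp → Set
Φ ≤# Ψ = (α Φ ≡ α Ψ)
       × (atomicFactors Φ ≡ map st (chop (atomicLengths Φ) Ψ))

_≤#?_ : (Φ Ψ : SetComp) → Dec (Φ ≤# Ψ)
Φ ≤#? Ψ = (α Φ ≟α α Ψ)
        ×-dec ≡-dec _≟SC_ (atomicFactors Φ) (map st (chop (atomicLengths Φ) Ψ))

-- NCQSym^* : formal finite Q-linear combinations of the W_Φ.

Elem : Set
Elem = List (ℚ × SetComp)

sumℚ : List ℚ → ℚ
sumℚ = foldr _+ℚ_ 0ℚ

coeff : Elem → SetComp → ℚ
coeff x Θ = sumℚ (map Data.Product.proj₁ (filter (λ p → Data.Product.proj₂ p ≟SC Θ) x))

_≈_ : Elem → Elem → Set
x ≈ y = ∀ Θ → coeff x Θ ≡ coeff y Θ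

W : SetComp → Elem
W Φ = (1ℚ , Φ) ∷ []

size : SetComp → ℕ
size Φ = length (concat Φ)

choose : ℕ → List ℕ → List (List ℕ)
choose m xs = filter (λ S → length S ≟ m) (sublists xs)

-- the basis product  W_Φ W_Ψ = Σ_{S ∈ binom([n+k],n)} W_{Φ↑S · Ψ↑([n+k]∖S)}
mulW : SetComp → SetComp → List SetComp
mulW Φ Ψ =
  map (λ S → (Φ ↑ S) ++ (Ψ ↑ filter (λ x → ¬? (x ∈? S)) (range (size Φ + size Ψ))))
      (choose (size Φ) (range (size Φ + size Ψ)))

_⋆_ : Elem → Elem → Elem
x ⋆ y = concatMap (λ p → concatMap (λ q →
          map (λ Θ → (Data.Product.proj₁ p *ℚ Data.Product.proj₁ q) , Θ)
              (mulW (Data.Product.proj₂ p) (Data.Product.proj₂ q))) y) x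

V : ℕ → SetComp → Elem
V n Φ = map (λ Φ' → (1ℚ , Φ')) (filter (λ Φ' → Φ ≤#? Φ') (allSetComps n))

-- Both V_Φ V_Ψ and V_{Φ|Ψ} are sums of distinct basis elements W_Θ with
-- coefficient 1, so it suffices to match their supports.  Expanding the
-- product gives the terms Φ'↑S · Ψ'↑([n+k]∖S) with Φ ≤# Φ', Ψ ≤# Ψ' and S an
-- n-subset of [n+k]; distinct triples give distinct terms, since S is the set
-- of entries of the first ℓ(Φ) blocks and Φ', Ψ' are recovered by
-- standardization.  The cut points of Φ|Ψ are those of Φ followed by those of
-- Ψ shifted by ℓ(Φ), so the atomic factors of Φ|Ψ are those of Φ followed by
-- those of Ψ; as ≤# only depends on standardizations, it is invariant under
-- order-preserving relabelling, and therefore Φ|Ψ ≤# Θ holds exactly when Θ is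
-- such a term.
module Submission where

open import Defs
open import Data.Nat using (ℕ; zero; suc; _+_; _∸_; _≤_; _<_; _≟_; _≤?_; z≤n; s≤s)
open import Data.Nat.Properties
open import Data.Nat.ListAction using (sum)
open import Data.List using (List; []; _∷_; _++_; map; concat; concatMap; length; filter; upTo; take; drop; applyUpTo)
import Data.List.Properties as Listₚ
open import Data.List.Relation.Unary.All using (All; []; _∷_)
import Data.List.Relation.Unary.All as All
import Data.List.Relation.Unary.All.Properties as Allₚ
open import Data.List.Relation.Unary.AllPairs using (AllPairs; []; _∷_)
import Data.List.Relation.Unary.AllPairs as AllPairs
import Data.List.Relation.Unary.AllPairs.Properties as AllPairsₚ
open import Data.List.Relation.Unary.Any using (here; there)
import Data.List.Relation.Unary.Any as Any
open import Data.List.Relation.Unary.Unique.Propositional using (Unique)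
import Data.List.Relation.Unary.Unique.Propositional.Properties as Uniqueₚ
open import Data.List.Relation.Binary.Subset.Propositional using (_⊆_)
open import Data.List.Relation.Binary.Subset.Propositional.Properties using (concat⁺)
open import Data.List.Relation.Binary.Permutation.Propositional using (_↭_; ↭-refl; ↭-sym; ↭-trans; prep)
import Data.List.Relation.Binary.Permutation.Propositional.Properties as ↭ₚ
open import Data.List.Membership.Propositional using (_∈_; _∉_; find)
open import Data.List.Membership.Propositional.Properties
open import Data.List.Membership.DecPropositional _≟_ using (_∈?_)
open import Data.List.Membership.DecPropositional _≟SC_ using () renaming (_∈?_ to _∈SC?_)
open import Data.Product using (_×_; _,_; proj₁; proj₂; Σ)
open import Data.Sum using (inj₁; inj₂)
open import Data.Rational using (0ℚ; 1ℚ) renaming (_+_ to _+ℚ_; _*_ to _*ℚ_)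
import Data.Rational.Properties as ℚₚ
open import Relation.Nullary using (yes; no; ¬_; ¬?)
open import Relation.Unary using (Pred; Decidable)
open import Relation.Binary using (tri<; tri≈; tri>)
open import Relation.Binary.PropositionalEquality
open import Data.Empty using (⊥-elim)
open import Function using (_∘_; id)

private
  variable
    A B : Set

filter-cong-local : ∀ {p q} {P : Pred A p} {Q : Pred A q} (P? : Decidable P) (Q? : Decidable Q) xs →
  (∀ {y} → y ∈ xs → P y → Q y) → (∀ {y} → y ∈ xs → Q y → P y) → filter P? xs ≡ filter Q? xs
filter-cong-local P? Q? [] P⇒Q Q⇒P = refl
filter-cong-local P? Q? (y ∷ ys) P⇒Q Q⇒P with P? y | Q? y
... | yes _  | yes _  = cong (y ∷_) (filter-cong-local P? Q? ys (P⇒Q ∘ there) (Q⇒P ∘ there))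
... | no _   | no _   = filter-cong-local P? Q? ys (P⇒Q ∘ there) (Q⇒P ∘ there)
... | yes py | no ¬qy = ⊥-elim (¬qy (P⇒Q (here refl) py))
... | no ¬py | yes qy = ⊥-elim (¬py (Q⇒P (here refl) qy))

filter-map : ∀ {p} {P : Pred B p} (P? : Decidable P) (f : A → B) xs →
  filter P? (map f xs) ≡ map f (filter (P? ∘ f) xs)
filter-map P? f [] = refl
filter-map P? f (x ∷ xs) with P? (f x)
... | yes _ = cong (f x ∷_) (filter-map P? f xs)
... | no _  = filter-map P? f xs

length-filter-+-complement : ∀ {p} {P : Pred A p} (P? : Decidable P) xs →
  length (filter P? xs) + length (filter (¬? ∘ P?) xs) ≡ length xs
length-filter-+-complement P? [] = refl
length-filter-+-complement P? (x ∷ xs) with P? x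
... | yes _ = cong suc (length-filter-+-complement P? xs)
... | no _ = trans (+-suc _ _) (cong suc (length-filter-+-complement P? xs))

map-map-cong-local : ∀ {f g : ℕ → ℕ} (X : SetComp) →
  (∀ {x} → x ∈ concat X → f x ≡ g x) → map (map f) X ≡ map (map g) X
map-map-cong-local [] e = refl
map-map-cong-local (B ∷ X) e =
  cong₂ _∷_ (Listₚ.map-cong-local (All.tabulate (e ∘ ∈-++⁺ˡ))) (map-map-cong-local X (e ∘ ∈-++⁺ʳ B))

map-map-∘ : ∀ (f g : ℕ → ℕ) (X : SetComp) → map (map g) (map (map f) X) ≡ map (map (g ∘ f)) X
map-map-∘ f g X = trans (sym (Listₚ.map-∘ X)) (Listₚ.map-cong (λ B → sym (Listₚ.map-∘ B)) X)

map-map-id : ∀ (X : SetComp) → map (map id) X ≡ X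
map-map-id X = trans (Listₚ.map-cong Listₚ.map-id X) (Listₚ.map-id X)

α-map-map : ∀ (f : ℕ → ℕ) X → α (map (map f) X) ≡ α X
α-map-map f X = trans (sym (Listₚ.map-∘ X)) (Listₚ.map-cong (Listₚ.length-map f) X)

ℓ-cong-α : ∀ {X Y : SetComp} → α X ≡ α Y → ℓ X ≡ ℓ Y
ℓ-cong-α {X} {Y} e = trans (sym (Listₚ.length-map length X)) (trans (cong length e) (Listₚ.length-map length Y))

size≡sum-α : ∀ (X : SetComp) → size X ≡ sum (α X)
size≡sum-α [] = refl
size≡sum-α (B ∷ X) = trans (Listₚ.length-++ B) (cong (length B +_) (size≡sum-α X))

size-cong-α : ∀ {X Y : SetComp} → α X ≡ α Y → size X ≡ size Y
size-cong-α {X} {Y} e = trans (size≡sum-α X) (trans (cong sum e) (sym (size≡sum-α Y)))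

take-⊆ : ∀ l (xs : List A) → take l xs ⊆ xs
take-⊆ zero xs ()
take-⊆ (suc l) [] ()
take-⊆ (suc l) (x ∷ xs) (here eq) = here eq
take-⊆ (suc l) (x ∷ xs) (there m) = there (take-⊆ l xs m)

drop-⊆ : ∀ l (xs : List A) → drop l xs ⊆ xs
drop-⊆ zero xs m = m
drop-⊆ (suc l) [] ()
drop-⊆ (suc l) (x ∷ xs) m = there (drop-⊆ l xs m)

take-++-≤ : ∀ j (X Y : List A) → j ≤ length X → take j (X ++ Y) ≡ take j X
take-++-≤ zero X Y _ = refl
take-++-≤ (suc j) (x ∷ X) Y (s≤s j≤) = cong (x ∷_) (take-++-≤ j X Y j≤)

take-++-length : ∀ {j} (X Y : List A) → length X ≡ j → take j (X ++ Y) ≡ X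
take-++-length X Y refl = trans (take-++-≤ (length X) X Y ≤-refl) (Listₚ.take-all (length X) X ≤-refl)

drop-++-length : ∀ {j} (X Y : List A) → length X ≡ j → drop j (X ++ Y) ≡ Y
drop-++-length [] Y refl = refl
drop-++-length (x ∷ X) Y refl = drop-++-length X Y refl

take-++-+ : ∀ j (X Y : List A) → take (length X + j) (X ++ Y) ≡ X ++ take j Y
take-++-+ j [] Y = refl
take-++-+ j (x ∷ X) Y = cong (x ∷_) (take-++-+ j X Y)

take-take-+ : ∀ l s (Z : List A) → take l (take (l + s) Z) ≡ take l Z
take-take-+ zero s Z = refl
take-take-+ (suc l) s [] = refl
take-take-+ (suc l) s (z ∷ Z) = cong (z ∷_) (take-take-+ l s Z)

drop-take-+ : ∀ l s (Z : List A) → drop l (take (l + s) Z) ≡ take s (drop l Z)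
drop-take-+ zero s Z = refl
drop-take-+ (suc l) s [] = sym (Listₚ.take-[] s)
drop-take-+ (suc l) s (z ∷ Z) = drop-take-+ l s Z

++-injective : ∀ (a b c d : List A) → length a ≡ length c → a ++ b ≡ c ++ d → a ≡ c × b ≡ d
++-injective [] b [] d _ eq = refl , eq
++-injective (x ∷ a) b (y ∷ c) d |a|≡|c| eq with Listₚ.∷-injective eq
... | refl , eq′ with ++-injective a b c d (suc-injective |a|≡|c|) eq′
... | refl , b≡d = refl , b≡d

Increasing : List ℕ → Set
Increasing = AllPairs _<_

Increasing⇒Unique : ∀ {xs} → Increasing xs → Unique xs
Increasing⇒Unique = AllPairs.map <⇒≢

Unique-++⇒disjoint : ∀ {xs ys : List A} {z} → Unique (xs ++ ys) → z ∈ xs → z ∉ ys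
Unique-++⇒disjoint {xs = x ∷ xs} u@(_ ∷ _) (here refl) z∈ys = Uniqueₚ.Unique[x∷xs]⇒x∉xs u (∈-++⁺ʳ xs z∈ys)
Unique-++⇒disjoint {xs = x ∷ xs} (_ ∷ u) (there z∈xs) z∈ys = Unique-++⇒disjoint u z∈xs z∈ys

unique-remove : ∀ (as : List A) {x bs} → Unique (as ++ x ∷ bs) → x ∉ as ++ bs × Unique (as ++ bs)
unique-remove [] (x∉ ∷ u) = Allₚ.All¬⇒¬Any x∉ , u
unique-remove (a ∷ as) (a∉ ∷ u) with unique-remove as u
... | x∉ , u′ = x∉′ , All.tabulate (λ m → All.lookup a∉ (∈-insert-mid m)) ∷ u′
  where
  ∈-insert-mid : ∀ {z} → z ∈ as ++ _ → z ∈ as ++ _ ∷ _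
  ∈-insert-mid m with ∈-++⁻ as m
  ... | inj₁ q = ∈-++⁺ˡ q
  ... | inj₂ q = ∈-++⁺ʳ as (there q)
  x∉′ : _ ∉ a ∷ as ++ _
  x∉′ (here refl) = All.lookup a∉ (∈-++⁺ʳ as (here refl)) refl
  x∉′ (there q) = x∉ q

unique-⊆⊇⇒↭ : ∀ {xs ys : List A} → Unique xs → Unique ys → xs ⊆ ys → ys ⊆ xs → xs ↭ ys
unique-⊆⊇⇒↭ {xs = []} {[]} _ _ _ _ = ↭-refl
unique-⊆⊇⇒↭ {xs = []} {y ∷ ys} _ _ _ ys⊆ with ys⊆ (here refl)
... | ()
unique-⊆⊇⇒↭ {xs = x ∷ xs} {ys} (x∉ ∷ ux) uy xs⊆ ys⊆ with ∈-∃++ (xs⊆ (here refl))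
... | as , bs , refl with unique-remove as uy
... | x∉′ , uy′ = ↭-trans (prep x (unique-⊆⊇⇒↭ ux uy′ xs⊆′ ys⊆′)) (↭-sym (↭ₚ.shift x as bs))
  where
  xs⊆′ : xs ⊆ as ++ bs
  xs⊆′ m with ∈-++⁻ as (xs⊆ (there m))
  ... | inj₁ q = ∈-++⁺ˡ q
  ... | inj₂ (here refl) = ⊥-elim (Allₚ.All¬⇒¬Any x∉ m)
  ... | inj₂ (there q) = ∈-++⁺ʳ as q
  ys⊆′ : as ++ bs ⊆ xs
  ys⊆′ m with ∈-++⁻ as m
  ys⊆′ m | inj₁ q with ys⊆ (∈-++⁺ˡ q)
  ... | here refl = ⊥-elim (x∉′ m)
  ... | there r = r
  ys⊆′ m | inj₂ q with ys⊆ (∈-++⁺ʳ as (there q))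
  ... | here refl = ⊥-elim (x∉′ m)
  ... | there r = r

unique-⊆⊇⇒length≡ : ∀ {xs ys : List A} → Unique xs → Unique ys → xs ⊆ ys → ys ⊆ xs → length xs ≡ length ys
unique-⊆⊇⇒length≡ ux uy xs⊆ ys⊆ = ↭ₚ.↭-length (unique-⊆⊇⇒↭ ux uy xs⊆ ys⊆)

unique-⊆⊇⇒filter-length≡ : ∀ {p} {P : Pred A p} (P? : Decidable P) {xs ys : List A} →
  Unique xs → Unique ys → xs ⊆ ys → ys ⊆ xs → length (filter P? xs) ≡ length (filter P? ys)
unique-⊆⊇⇒filter-length≡ P? ux uy xs⊆ ys⊆ = ↭ₚ.↭-length (↭ₚ.filter-↭ P? (unique-⊆⊇⇒↭ ux uy xs⊆ ys⊆))

unique-map-local : ∀ (g : A → B) {xs} → Unique xs →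
  (∀ {a b} → a ∈ xs → b ∈ xs → g a ≡ g b → a ≡ b) → Unique (map g xs)
unique-map-local g {[]} _ _ = []
unique-map-local g {x ∷ xs} (x∉ ∷ u) inj =
  Allₚ.¬Any⇒All¬ _ gx∉ ∷ unique-map-local g u (λ a b → inj (there a) (there b))
  where
  gx∉ : g x ∉ map g xs
  gx∉ m with ∈-map⁻ g m
  ... | y , y∈ , eq = Allₚ.All¬⇒¬Any x∉ (subst (_∈ xs) (sym (inj (here refl) (there y∈) eq)) y∈)

unique-concatMap : ∀ (f : A → List B) {xs} → Unique xs → (∀ {x} → x ∈ xs → Unique (f x)) →
  (∀ {x x′ y} → x ∈ xs → x′ ∈ xs → y ∈ f x → y ∈ f x′ → x ≡ x′) → Unique (concatMap f xs)
unique-concatMap f {[]} _ _ _ = []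
unique-concatMap f {x ∷ xs} (x∉ ∷ u) uf fibres =
  Uniqueₚ.++⁺ (uf (here refl)) (unique-concatMap f u (uf ∘ there) (λ m m′ → fibres (there m) (there m′))) disjoint
  where
  disjoint : ∀ {v} → ¬ (v ∈ f x × v ∈ concatMap f xs)
  disjoint (v∈fx , v∈rest) with find (∈-concatMap⁻ f {xs = xs} v∈rest)
  ... | x′ , x′∈ , v∈fx′ =
    Allₚ.All¬⇒¬Any x∉ (subst (_∈ xs) (sym (fibres (here refl) (there x′∈) v∈fx v∈fx′)) x′∈)

∈-range⁻ : ∀ {n x} → x ∈ range n → 1 ≤ x × x ≤ n
∈-range⁻ m with ∈-map⁻ suc m
... | i , i∈ , refl = s≤s z≤n , ∈-upTo⁻ i∈

∈-range⁺ : ∀ {n x} → 1 ≤ x → x ≤ n → x ∈ range n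
∈-range⁺ {x = suc i} _ i<n = ∈-map⁺ suc (∈-upTo⁺ i<n)

∈-range-suc⁻ : ∀ {m x} → x ∈ range m → Σ ℕ (λ i → x ≡ suc i × i < m)
∈-range-suc⁻ m with ∈-range⁻ m
... | s≤s z≤n , i<m = _ , refl , i<m

range-increasing : ∀ n → Increasing (range n)
range-increasing n = AllPairsₚ.map⁺ (AllPairs.map s≤s (AllPairsₚ.applyUpTo⁺₁ id n (λ i<j _ → i<j)))

range-unique : ∀ n → Unique (range n)
range-unique n = Increasing⇒Unique (range-increasing n)

length-range : ∀ n → length (range n) ≡ n
length-range n = trans (Listₚ.length-map suc (upTo n)) (Listₚ.length-upTo n)

applyUpTo-+ : ∀ (f : ℕ → A) a b → applyUpTo f (a + b) ≡ applyUpTo f a ++ applyUpTo (f ∘ (a +_)) b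
applyUpTo-+ f zero b = refl
applyUpTo-+ f (suc a) b = cong (f 0 ∷_) (applyUpTo-+ (f ∘ suc) a b)

applyUpTo-cong : ∀ {f g : ℕ → A} → (∀ x → f x ≡ g x) → ∀ n → applyUpTo f n ≡ applyUpTo g n
applyUpTo-cong f≗g zero = refl
applyUpTo-cong f≗g (suc n) = cong₂ _∷_ (f≗g 0) (applyUpTo-cong (f≗g ∘ suc) n)

range-+ : ∀ a b → range (a + b) ≡ range a ++ map (a +_) (range b)
range-+ a b = begin
  map suc (upTo (a + b))                               ≡⟨ cong (map suc) (applyUpTo-+ id a b) ⟩
  map suc (upTo a ++ applyUpTo (a +_) b)               ≡⟨ Listₚ.map-++ suc (upTo a) _ ⟩
  range a ++ map suc (applyUpTo (a +_) b)              ≡⟨ cong (range a ++_) shifted ⟩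
  range a ++ map (a +_) (range b)                      ∎
  where
  open ≡-Reasoning
  shifted : map suc (applyUpTo (a +_) b) ≡ map (a +_) (map suc (upTo b))
  shifted = begin
    map suc (applyUpTo (a +_) b)        ≡⟨ Listₚ.map-applyUpTo (a +_) suc b ⟩
    applyUpTo (suc ∘ (a +_)) b          ≡⟨ applyUpTo-cong (λ x → sym (+-suc a x)) b ⟩
    applyUpTo ((a +_) ∘ suc) b          ≡⟨ Listₚ.map-applyUpTo suc (a +_) b ⟨
    map (a +_) (applyUpTo suc b)        ≡⟨ cong (map (a +_)) (Listₚ.map-applyUpTo id suc b) ⟨
    map (a +_) (map suc (upTo b))       ∎

range-suc : ∀ m → range (suc m) ≡ range m ++ suc m ∷ []
range-suc m = trans (cong (map suc) (sym (Listₚ.upTo-∷ʳ m))) (Listₚ.map-++ suc (upTo m) (m ∷ []))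

nth-∈ : ∀ S i → i < length S → nth S i ∈ S
nth-∈ (s ∷ S) zero _ = here refl
nth-∈ (s ∷ S) (suc i) (s≤s i<) = there (nth-∈ S i i<)

∈⇒nth : ∀ {S x} → x ∈ S → Σ ℕ (λ i → i < length S × nth S i ≡ x)
∈⇒nth (here refl) = zero , s≤s z≤n , refl
∈⇒nth (there m) with ∈⇒nth m
... | i , i< , eq = suc i , s≤s i< , eq

nth-strictMono : ∀ {S} → Increasing S → ∀ {i j} → i < j → j < length S → nth S i < nth S j
nth-strictMono {s ∷ S} (s< ∷ _) {zero} {suc j} _ (s≤s j<) = All.lookup s< (nth-∈ S j j<)
nth-strictMono {s ∷ S} (_ ∷ inc) {suc i} {suc j} (s≤s i<j) (s≤s j<) = nth-strictMono inc i<j j<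

nth-range : ∀ m i → i < m → nth (range m) i ≡ suc i
nth-range m i = go id m i
  where
  go : ∀ (f : ℕ → ℕ) m i → i < m → nth (map suc (applyUpTo f m)) i ≡ suc (f i)
  go f (suc m) zero _ = refl
  go f (suc m) (suc i) (s≤s i<m) = go (f ∘ suc) m i i<m

-- st X unfolds to map (map (rank (concat X))) X.
rank : List ℕ → ℕ → ℕ
rank D x = length (filter (_≤? x) D)

rank-nth : ∀ {S} → Increasing S → ∀ i → i < length S → rank S (nth S i) ≡ suc i
rank-nth {s ∷ S} (s< ∷ _) zero _ =
  trans (cong length (Listₚ.filter-accept (_≤? s) ≤-refl))
        (cong suc (cong length (Listₚ.filter-none (_≤? s) (All.map <⇒≱ s<))))
rank-nth {s ∷ S} (s< ∷ inc) (suc i) (s≤s i<) =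
  trans (cong length (Listₚ.filter-accept (_≤? nth S i) (<⇒≤ (All.lookup s< (nth-∈ S i i<)))))
        (cong suc (rank-nth inc i i<))

rank-∈ : ∀ {S} → Increasing S → ∀ {x} → x ∈ S → Σ ℕ (λ i → i < length S × nth S i ≡ x × rank S x ≡ suc i)
rank-∈ inc x∈ with ∈⇒nth x∈
... | i , i< , refl = i , i< , refl , rank-nth inc i i<

[]∈sublists : ∀ xs → [] ∈ sublists xs
[]∈sublists [] = here refl
[]∈sublists (x ∷ xs) = ∈-++⁺ʳ (map (x ∷_) (sublists xs)) ([]∈sublists xs)

⊆-∷⁻ : ∀ {x : A} {xs B} → x ∉ B → B ⊆ x ∷ xs → B ⊆ xs
⊆-∷⁻ x∉B B⊆ c∈ with B⊆ c∈
... | here refl = ⊥-elim (x∉B c∈)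
... | there c∈xs = c∈xs

head-≤ : ∀ {b B c} → Increasing (b ∷ B) → c ∈ b ∷ B → b ≤ c
head-≤ _ (here refl) = ≤-refl
head-≤ (b< ∷ _) (there c∈) = <⇒≤ (All.lookup b< c∈)

∈-sublists⁺ : ∀ {xs B} → Increasing xs → Increasing B → B ⊆ xs → B ∈ sublists xs
∈-sublists⁺ {[]} {[]} _ _ _ = here refl
∈-sublists⁺ {[]} {b ∷ B} _ _ B⊆ with B⊆ (here refl)
... | ()
∈-sublists⁺ {x ∷ xs} {[]} _ _ _ = []∈sublists (x ∷ xs)
∈-sublists⁺ {x ∷ xs} {b ∷ B} (x< ∷ incx) incB@(b< ∷ incB′) B⊆ with B⊆ (here refl)
... | here refl = ∈-++⁺ˡ (∈-map⁺ (x ∷_) (∈-sublists⁺ incx incB′ (⊆-∷⁻ x∉B (B⊆ ∘ there))))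
  where
  x∉B : x ∉ B
  x∉B x∈ = <-irrefl refl (All.lookup b< x∈)
... | there b∈ = ∈-++⁺ʳ (map (x ∷_) (sublists xs)) (∈-sublists⁺ incx incB (⊆-∷⁻ x∉ B⊆))
  where
  x∉ : x ∉ b ∷ B
  x∉ x∈ = <⇒≱ (All.lookup x< b∈) (head-≤ incB x∈)

∈-sublists⁻ : ∀ {xs B} → B ∈ sublists xs → B ⊆ xs
∈-sublists⁻ {[]} (here refl) ()
∈-sublists⁻ {x ∷ xs} m with ∈-++⁻ (map (x ∷_) (sublists xs)) m
... | inj₂ B∈ = there ∘ ∈-sublists⁻ B∈
... | inj₁ q with ∈-map⁻ (x ∷_) q
... | B′ , B′∈ , refl = λ { (here refl) → here refl ; (there z∈) → there (∈-sublists⁻ B′∈ z∈) }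

sublists-increasing : ∀ {xs B} → Increasing xs → B ∈ sublists xs → Increasing B
sublists-increasing {[]} _ (here refl) = []
sublists-increasing {x ∷ xs} (x< ∷ inc) m with ∈-++⁻ (map (x ∷_) (sublists xs)) m
... | inj₂ B∈ = sublists-increasing inc B∈
... | inj₁ q with ∈-map⁻ (x ∷_) q
... | B′ , B′∈ , refl = All.tabulate (All.lookup x< ∘ ∈-sublists⁻ B′∈) ∷ sublists-increasing inc B′∈

sublists-unique : ∀ {xs} → Unique xs → Unique (sublists xs)
sublists-unique {[]} _ = [] ∷ []
sublists-unique {x ∷ xs} (x∉ ∷ u) =
  Uniqueₚ.++⁺ (Uniqueₚ.map⁺ (proj₂ ∘ Listₚ.∷-injective) (sublists-unique u)) (sublists-unique u) disjoint
  where
  disjoint : ∀ {v} → ¬ (v ∈ map (x ∷_) (sublists xs) × v ∈ sublists xs)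
  disjoint (m₁ , m₂) with ∈-map⁻ (x ∷_) m₁
  ... | _ , _ , refl = Allₚ.All¬⇒¬Any x∉ (∈-sublists⁻ m₂ (here refl))

filter-∈-sublists : ∀ {xs B} → Unique xs → B ∈ sublists xs → filter (_∈? B) xs ≡ B
filter-∈-sublists {[]} _ (here refl) = refl
filter-∈-sublists {x ∷ xs} {B} (x∉ ∷ u) m with ∈-++⁻ (map (x ∷_) (sublists xs)) m
... | inj₂ B∈ = trans (Listₚ.filter-reject (_∈? B) (Allₚ.All¬⇒¬Any x∉ ∘ ∈-sublists⁻ B∈)) (filter-∈-sublists u B∈)
... | inj₁ q with ∈-map⁻ (x ∷_) q
... | B′ , B′∈ , refl =
  trans (Listₚ.filter-accept (_∈? (x ∷ B′)) (here refl))
        (cong (x ∷_) (trans (filter-cong-local (_∈? (x ∷ B′)) (_∈? B′) xs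
                               not-x (λ _ → there))
                            (filter-∈-sublists u B′∈)))
  where
  not-x : ∀ {y} → y ∈ xs → y ∈ x ∷ B′ → y ∈ B′
  not-x y∈xs (here refl) = ⊥-elim (Allₚ.All¬⇒¬Any x∉ y∈xs)
  not-x _ (there y∈) = y∈

∈-words⁺ : ∀ l (L : List A) w → length w ≡ l → All (_∈ L) w → w ∈ words l L
∈-words⁺ zero L [] refl [] = here refl
∈-words⁺ (suc l) L (x ∷ w) refl (x∈ ∷ w∈) =
  ∈-concatMap⁺ (λ y → map (y ∷_) (words l L)) (Any.map (λ { refl → ∈-map⁺ (x ∷_) (∈-words⁺ l L w refl w∈) }) x∈)

∈-words⁻-length : ∀ l (L : List A) {w} → w ∈ words l L → length w ≡ l
∈-words⁻-length zero L (here refl) = refl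
∈-words⁻-length (suc l) L m with find (∈-concatMap⁻ (λ y → map (y ∷_) (words l L)) {xs = L} m)
... | x , _ , m′ with ∈-map⁻ (x ∷_) m′
... | w′ , w′∈ , refl = cong suc (∈-words⁻-length l L w′∈)

words-unique : ∀ l {L : List A} → Unique L → Unique (words l L)
words-unique zero u = [] ∷ []
words-unique (suc l) {L} u =
  unique-concatMap (λ y → map (y ∷_) (words l L)) u
    (λ _ → Uniqueₚ.map⁺ (proj₂ ∘ Listₚ.∷-injective) (words-unique l u)) same-head
  where
  same-head : ∀ {x x′ w} → x ∈ L → x′ ∈ L →
    w ∈ map (x ∷_) (words l L) → w ∈ map (x′ ∷_) (words l L) → x ≡ x′
  same-head _ _ m m′ with ∈-map⁻ _ m | ∈-map⁻ _ m′
  ... | _ , _ , refl | _ , _ , eq = proj₁ (Listₚ.∷-injective eq)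

IsBlock : Block → Set
IsBlock B = (0 < length B) × Increasing B

IsPartial : SetComp → Set
IsPartial X = All IsBlock X × AllPairs Disjoint X

IsSetComp⇒IsPartial : ∀ {n X} → IsSetComp n X → IsPartial X
IsSetComp⇒IsPartial (blocks , disjoint , _) = blocks , disjoint

entries-unique : ∀ {X} → IsPartial X → Unique (concat X)
entries-unique (blocks , disjoint) =
  Uniqueₚ.concat⁺ (All.map (Increasing⇒Unique ∘ proj₂) blocks)
                  (AllPairs.map (λ d {v} (v∈A , v∈B) → All.lookup d v∈A v∈B) disjoint)

size≡ : ∀ {n X} → IsSetComp n X → size X ≡ n
size≡ {n} sc@(_ , _ , ⊆range , range⊆) =
  trans (unique-⊆⊇⇒length≡ (entries-unique (IsSetComp⇒IsPartial sc)) (range-unique n)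
                           (All.lookup ⊆range) (All.lookup range⊆))
        (length-range n)

ℓ≤size : ∀ {X} → All IsBlock X → ℓ X ≤ size X
ℓ≤size {[]} [] = z≤n
ℓ≤size {B ∷ X} ((0<|B| , _) ∷ blocks) =
  subst (suc (ℓ X) ≤_) (sym (Listₚ.length-++ B)) (+-mono-≤ 0<|B| (ℓ≤size blocks))

∈-allSetComps⁻ : ∀ {n X} → X ∈ allSetComps n → IsSetComp n X
∈-allSetComps⁻ {n} m = proj₂ (∈-filter⁻ (isSetComp? n) {xs = concatMap (λ l → words l (sublists (range n))) (upTo (suc n))} m)

∈-allSetComps⁺ : ∀ {n X} → IsSetComp n X → X ∈ allSetComps n
∈-allSetComps⁺ {n} {X} sc@(blocks , _ , ⊆range , _) =
  ∈-filter⁺ (isSetComp? n)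
    (∈-concatMap⁺ (λ l → words l (sublists (range n)))
      (Any.map (λ { refl → ∈-words⁺ (ℓ X) _ X refl (blocks∈ blocks (Allₚ.concat⁻ ⊆range)) })
               (∈-upTo⁺ (s≤s (subst (ℓ X ≤_) (size≡ sc) (ℓ≤size blocks))))))
    sc
  where
  blocks∈ : ∀ {Y} → All IsBlock Y → All (All (_∈ range n)) Y → All (_∈ sublists (range n)) Y
  blocks∈ [] [] = []
  blocks∈ ((_ , inc) ∷ bs) (⊆r ∷ ⊆rs) = ∈-sublists⁺ (range-increasing n) inc (All.lookup ⊆r) ∷ blocks∈ bs ⊆rs

allSetComps-unique : ∀ n → Unique (allSetComps n)
allSetComps-unique n =
  Uniqueₚ.filter⁺ (isSetComp? n)
    (unique-concatMap (λ l → words l (sublists (range n))) (Uniqueₚ.upTo⁺ (suc n))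
      (λ {l} _ → words-unique l (sublists-unique (range-unique n)))
      (λ {l} {l′} _ _ m m′ → trans (sym (∈-words⁻-length l _ m)) (∈-words⁻-length l′ _ m′)))

-- Order-preserving relabelling

StrictlyMonotoneOn : List ℕ → (ℕ → ℕ) → Set
StrictlyMonotoneOn C f = ∀ {x y} → x ∈ C → y ∈ C → x < y → f x < f y

strictlyMonotoneOn-⊆ : ∀ {f C D} → D ⊆ C → StrictlyMonotoneOn C f → StrictlyMonotoneOn D f
strictlyMonotoneOn-⊆ D⊆C mono x∈ y∈ = mono (D⊆C x∈) (D⊆C y∈)

strictlyMonotoneOn⇒injective : ∀ {f C} → StrictlyMonotoneOn C f → ∀ {x y} → x ∈ C → y ∈ C → f x ≡ f y → x ≡ y
strictlyMonotoneOn⇒injective mono {x} {y} x∈ y∈ eq with <-cmp x y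
... | tri< x<y _ _ = ⊥-elim (<⇒≢ (mono x∈ y∈ x<y) eq)
... | tri≈ _ x≡y _ = x≡y
... | tri> _ _ y<x = ⊥-elim (<⇒≢ (mono y∈ x∈ y<x) (sym eq))

strictlyMonotoneOn⇒≤-iff : ∀ {f C} → StrictlyMonotoneOn C f → ∀ {x y} → x ∈ C → y ∈ C → f y ≤ f x → y ≤ x
strictlyMonotoneOn⇒≤-iff mono x∈ y∈ fy≤fx = ≮⇒≥ (λ x<y → <⇒≱ (mono x∈ y∈ x<y) fy≤fx)

strictlyMonotoneOn⇒monotoneOn : ∀ {f C} → StrictlyMonotoneOn C f → ∀ {x y} → x ∈ C → y ∈ C → y ≤ x → f y ≤ f x
strictlyMonotoneOn⇒monotoneOn mono x∈ y∈ y≤x with m≤n⇒m<n∨m≡n y≤x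
... | inj₁ y<x = <⇒≤ (mono y∈ x∈ y<x)
... | inj₂ refl = ≤-refl

AllPairs-map-local : ∀ {R : A → A → Set} {R′ : B → B → Set} (g : A → B) {xs} →
  (∀ {x y} → x ∈ xs → y ∈ xs → R x y → R′ (g x) (g y)) → AllPairs R xs → AllPairs R′ (map g xs)
AllPairs-map-local g {[]} _ [] = []
AllPairs-map-local {R = R} {R′} g {x ∷ xs} pres (Rx ∷ Rs) =
  All-map-local id Rx ∷ AllPairs-map-local g (λ y∈ z∈ → pres (there y∈) (there z∈)) Rs
  where
  All-map-local : ∀ {ys} → ys ⊆ xs → All (R x) ys → All (R′ (g x)) (map g ys)
  All-map-local {[]} _ [] = []
  All-map-local {y ∷ ys} ⊆xs (r ∷ rs) = pres (here refl) (there (⊆xs (here refl))) r ∷ All-map-local (⊆xs ∘ there) rs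

IsPartial-relabel : ∀ {f X} → IsPartial X → StrictlyMonotoneOn (concat X) f → IsPartial (map (map f) X)
IsPartial-relabel {f} {X} (blocks , disjoint) mono = relabelBlocks X blocks id , AllPairs-map-local (map f) relabelDisjoint disjoint
  where
  relabelBlocks : ∀ Y → All IsBlock Y → concat Y ⊆ concat X → All IsBlock (map (map f) Y)
  relabelBlocks [] [] _ = []
  relabelBlocks (B ∷ Y) ((0<|B| , inc) ∷ bs) ⊆X =
    (subst (0 <_) (sym (Listₚ.length-map f B)) 0<|B| ,
     AllPairs-map-local f (λ x∈ y∈ → mono (⊆X (∈-++⁺ˡ x∈)) (⊆X (∈-++⁺ˡ y∈))) inc)
    ∷ relabelBlocks Y bs (⊆X ∘ ∈-++⁺ʳ B)
  relabelDisjoint : ∀ {A B} → A ∈ X → B ∈ X → Disjoint A B → Disjoint (map f A) (map f B)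
  relabelDisjoint {A} {B} A∈ B∈ d = Allₚ.map⁺ (All.tabulate fx∉)
    where
    fx∉ : ∀ {x} → x ∈ A → f x ∉ map f B
    fx∉ x∈ fx∈ with ∈-map⁻ f fx∈
    ... | y , y∈ , eq = All.lookup d x∈ (subst (_∈ B) (sym x≡y) y∈)
      where x≡y = strictlyMonotoneOn⇒injective mono (∈-concat⁺′ x∈ A∈) (∈-concat⁺′ y∈ B∈) eq

st-relabel : ∀ {f X} → StrictlyMonotoneOn (concat X) f → st (map (map f) X) ≡ st X
st-relabel {f} {X} mono = begin
  map (map (rank (concat (map (map f) X)))) (map (map f) X)
    ≡⟨ cong (λ D → map (map (rank D)) (map (map f) X)) (Listₚ.concat-map X) ⟩
  map (map (rank (map f (concat X)))) (map (map f) X)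
    ≡⟨ map-map-∘ f (rank (map f (concat X))) X ⟩
  map (map (rank (map f (concat X)) ∘ f)) X
    ≡⟨ map-map-cong-local X rank-relabel ⟩
  map (map (rank (concat X))) X ∎
  where
  open ≡-Reasoning
  rank-relabel : ∀ {x} → x ∈ concat X → rank (map f (concat X)) (f x) ≡ rank (concat X) x
  rank-relabel {x} x∈ = begin
    length (filter (_≤? f x) (map f (concat X)))        ≡⟨ cong length (filter-map (_≤? f x) f (concat X)) ⟩
    length (map f (filter ((_≤? f x) ∘ f) (concat X)))  ≡⟨ Listₚ.length-map f (filter ((_≤? f x) ∘ f) (concat X)) ⟩
    length (filter ((_≤? f x) ∘ f) (concat X))          ≡⟨ cong length (filter-cong-local _ (_≤? x) (concat X)
                                                             (strictlyMonotoneOn⇒≤-iff mono x∈)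
                                                             (strictlyMonotoneOn⇒monotoneOn mono x∈)) ⟩
    rank (concat X) x                                    ∎

chop-map : ∀ (g : A → B) ls (X : List A) → chop ls (map g X) ≡ map (map g) (chop ls X)
chop-map g [] X = refl
chop-map g (l ∷ ls) X =
  cong₂ _∷_ (Listₚ.take-map l X) (trans (cong (chop ls) (Listₚ.drop-map l X)) (chop-map g ls (drop l X)))

∈-chop⁻-⊆ : ∀ ls (X : List A) {Y} → Y ∈ chop ls X → Y ⊆ X
∈-chop⁻-⊆ (l ∷ ls) X (here refl) = take-⊆ l X
∈-chop⁻-⊆ (l ∷ ls) X (there Y∈) = drop-⊆ l X ∘ ∈-chop⁻-⊆ ls (drop l X) Y∈

length-chop : ∀ ls (X : List A) → length (chop ls X) ≡ length ls
length-chop [] X = refl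
length-chop (l ∷ ls) X = cong suc (length-chop ls (drop l X))

chop-++ : ∀ ls₁ ls₂ (Z : List A) → chop (ls₁ ++ ls₂) Z ≡ chop ls₁ (take (sum ls₁) Z) ++ chop ls₂ (drop (sum ls₁) Z)
chop-++ [] ls₂ Z = refl
chop-++ (l ∷ ls₁) ls₂ Z =
  cong₂ _∷_ (sym (take-take-+ l (sum ls₁) Z))
    (trans (chop-++ ls₁ ls₂ (drop l Z))
           (cong₂ _++_ (cong (chop ls₁) (sym (drop-take-+ l (sum ls₁) Z)))
                       (cong (chop ls₂) (Listₚ.drop-drop l (sum ls₁) Z))))

standardizedChunks : List ℕ → SetComp → List SetComp
standardizedChunks ls X = map st (chop ls X)

standardizedChunks-relabel : ∀ {f} ls X → StrictlyMonotoneOn (concat X) f →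
  standardizedChunks ls (map (map f) X) ≡ standardizedChunks ls X
standardizedChunks-relabel {f} ls X mono = begin
  map st (chop ls (map (map f) X))        ≡⟨ cong (map st) (chop-map (map f) ls X) ⟩
  map st (map (map (map f)) (chop ls X))  ≡⟨ Listₚ.map-∘ (chop ls X) ⟨
  map (st ∘ map (map f)) (chop ls X)      ≡⟨ Listₚ.map-cong-local (All.tabulate st-chunk) ⟩
  map st (chop ls X)                      ∎
  where
  open ≡-Reasoning
  st-chunk : ∀ {Y} → Y ∈ chop ls X → st (map (map f) Y) ≡ st Y
  st-chunk Y∈ = st-relabel (strictlyMonotoneOn-⊆ (concat⁺ (∈-chop⁻-⊆ ls X Y∈)) mono)

≤#-relabel : ∀ {f Φ X} → StrictlyMonotoneOn (concat X) f → Φ ≤# X → Φ ≤# map (map f) X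
≤#-relabel {f} {Φ} {X} mono (α≡ , factors≡) =
  trans α≡ (sym (α-map-map f X)) ,
  trans factors≡ (sym (standardizedChunks-relabel (atomicLengths Φ) X mono))

-- The atomic factorization of Φ|Ψ

lastOr : ℕ → List ℕ → ℕ
lastOr p [] = p
lastOr p (x ∷ xs) = lastOr x xs

lastOr-∷ʳ : ∀ p xs y → lastOr p (xs ++ y ∷ []) ≡ y
lastOr-∷ʳ p [] y = refl
lastOr-∷ʳ p (x ∷ xs) y = lastOr-∷ʳ x xs y

diffs-++ : ∀ p xs ys → diffs p (xs ++ ys) ≡ diffs p xs ++ diffs (lastOr p xs) ys
diffs-++ p [] ys = refl
diffs-++ p (x ∷ xs) ys = cong ((x ∸ p) ∷_) (diffs-++ x xs ys)

diffs-shift : ∀ L p ds → diffs (L + p) (map (L +_) ds) ≡ diffs p ds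
diffs-shift L p [] = refl
diffs-shift L p (d ∷ ds) = cong₂ _∷_ ([m+n]∸[m+o]≡n∸o L d p) (diffs-shift L d ds)

sum-diffs : ∀ p cs → All (p ≤_) cs → AllPairs _≤_ cs → p + sum (diffs p cs) ≡ lastOr p cs
sum-diffs p [] _ _ = +-identityʳ p
sum-diffs p (c ∷ cs) (p≤c ∷ _) (c≤ ∷ ≤s) =
  trans (sym (+-assoc p (c ∸ p) _)) (trans (cong (_+ sum (diffs c cs)) (m+[n∸m]≡n p≤c)) (sum-diffs c cs c≤ ≤s))

-- ClosedPrefix Φ j unfolds to IsInitialSegment (concat (take j Φ)).
IsInitialSegment : List ℕ → Set
IsInitialSegment D = All (_∈ range (length D)) D

IsInitialSegment-entries : ∀ {n X} → IsSetComp n X → IsInitialSegment (concat X)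
IsInitialSegment-entries {n} sc@(_ , _ , ⊆range , _) = subst (λ m → All (_∈ range m) _) (sym (size≡ sc)) ⊆range

lastOr-cuts : ∀ {n X} → IsSetComp n X → lastOr 0 (cuts X) ≡ ℓ X
lastOr-cuts {X = []} _ = refl
lastOr-cuts {X = B ∷ X} sc = begin
  lastOr 0 (filter closed? (range (suc (ℓ X))))                      ≡⟨ cong (lastOr 0 ∘ filter closed?) (range-suc (ℓ X)) ⟩
  lastOr 0 (filter closed? (range (ℓ X) ++ suc (ℓ X) ∷ []))          ≡⟨ cong (lastOr 0) (Listₚ.filter-++ closed? (range (ℓ X)) _) ⟩
  lastOr 0 (filter closed? (range (ℓ X)) ++ filter closed? (suc (ℓ X) ∷ []))
    ≡⟨ cong (λ r → lastOr 0 (filter closed? (range (ℓ X)) ++ r)) (Listₚ.filter-accept closed? whole-closed) ⟩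
  lastOr 0 (filter closed? (range (ℓ X)) ++ suc (ℓ X) ∷ [])          ≡⟨ lastOr-∷ʳ 0 (filter closed? (range (ℓ X))) (suc (ℓ X)) ⟩
  suc (ℓ X)                                                          ∎
  where
  open ≡-Reasoning
  closed? = closedPrefix? (B ∷ X)
  whole-closed : ClosedPrefix (B ∷ X) (suc (ℓ X))
  whole-closed = subst (IsInitialSegment ∘ concat) (sym (Listₚ.take-all (suc (ℓ X)) (B ∷ X) ≤-refl))
                       (IsInitialSegment-entries sc)

sum-atomicLengths : ∀ {n X} → IsSetComp n X → sum (atomicLengths X) ≡ ℓ X
sum-atomicLengths {X = X} sc =
  trans (sum-diffs 0 (cuts X) (All.universal (λ _ → z≤n) _)
                   (AllPairs.map <⇒≤ (AllPairsₚ.filter⁺ (closedPrefix? X) (range-increasing (ℓ X)))))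
        (lastOr-cuts sc)

length-++-shift : ∀ {n} (A C : List ℕ) → length A ≡ n → length (A ++ map (n +_) C) ≡ n + length C
length-++-shift {n} A C |A|≡n = trans (Listₚ.length-++ A) (cong₂ _+_ |A|≡n (Listₚ.length-map (n +_) C))

IsInitialSegment-++-shift⁻ : ∀ n (A C : List ℕ) → length A ≡ n → All (1 ≤_) C →
  IsInitialSegment (A ++ map (n +_) C) → IsInitialSegment C
IsInitialSegment-++-shift⁻ n A C |A|≡n 1≤C seg = All.zipWith bound (1≤C , Allₚ.map⁻ (Allₚ.++⁻ʳ A seg))
  where
  bound : ∀ {x} → 1 ≤ x × n + x ∈ range (length (A ++ map (n +_) C)) → x ∈ range (length C)
  bound (1≤x , n+x∈) =
    ∈-range⁺ 1≤x (+-cancelˡ-≤ n _ _ (subst (_ ≤_) (length-++-shift A C |A|≡n) (proj₂ (∈-range⁻ n+x∈))))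

IsInitialSegment-++-shift⁺ : ∀ n (A C : List ℕ) → length A ≡ n → All (_∈ range n) A →
  IsInitialSegment C → IsInitialSegment (A ++ map (n +_) C)
IsInitialSegment-++-shift⁺ n A C |A|≡n A⊆ seg = Allₚ.++⁺ (All.map inA A⊆) (Allₚ.map⁺ (All.map inC seg))
  where
  |A++C| = length-++-shift A C |A|≡n
  inA : ∀ {x} → x ∈ range n → x ∈ range (length (A ++ map (n +_) C))
  inA x∈ with ∈-range⁻ x∈
  ... | 1≤x , x≤n = ∈-range⁺ 1≤x (subst (_ ≤_) (sym |A++C|) (≤-trans x≤n (m≤m+n n (length C))))
  inC : ∀ {x} → x ∈ range (length C) → n + x ∈ range (length (A ++ map (n +_) C))
  inC {x} x∈ with ∈-range⁻ x∈
  ... | 1≤x , x≤ = ∈-range⁺ (≤-trans 1≤x (m≤n+m x n)) (subst (_ ≤_) (sym |A++C|) (+-monoʳ-≤ n x≤))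

cuts-bar : ∀ {n k Φ Ψ} → IsSetComp n Φ → IsSetComp k Ψ → cuts (bar n Φ Ψ) ≡ cuts Φ ++ map (ℓ Φ +_) (cuts Ψ)
cuts-bar {n} {k} {Φ} {Ψ} sΦ sΨ@(_ , _ , Ψ⊆range , _) = begin
  filter closed? (range (ℓ (bar n Φ Ψ)))                                        ≡⟨ cong (filter closed?) range-ℓ ⟩
  filter closed? (range (ℓ Φ) ++ map (ℓ Φ +_) (range (ℓ Ψ)))                    ≡⟨ Listₚ.filter-++ closed? (range (ℓ Φ)) _ ⟩
  filter closed? (range (ℓ Φ)) ++ filter closed? (map (ℓ Φ +_) (range (ℓ Ψ)))   ≡⟨ cong₂ _++_ cuts-left cuts-right ⟩
  cuts Φ ++ map (ℓ Φ +_) (cuts Ψ)                                               ∎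
  where
  open ≡-Reasoning
  closed? = closedPrefix? (bar n Φ Ψ)
  Ψ↑ = map (map (n +_)) Ψ
  range-ℓ : range (ℓ (bar n Φ Ψ)) ≡ range (ℓ Φ) ++ map (ℓ Φ +_) (range (ℓ Ψ))
  range-ℓ = trans (cong range (trans (Listₚ.length-++ Φ) (cong (ℓ Φ +_) (Listₚ.length-map (map (n +_)) Ψ))))
                  (range-+ (ℓ Φ) (ℓ Ψ))
  take-left : ∀ {j} → j ∈ range (ℓ Φ) → take j (bar n Φ Ψ) ≡ take j Φ
  take-left j∈ = take-++-≤ _ Φ Ψ↑ (proj₂ (∈-range⁻ j∈))
  cuts-left : filter closed? (range (ℓ Φ)) ≡ cuts Φ
  cuts-left = filter-cong-local closed? (closedPrefix? Φ) (range (ℓ Φ))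
    (λ j∈ → subst (IsInitialSegment ∘ concat) (take-left j∈))
    (λ j∈ → subst (IsInitialSegment ∘ concat) (sym (take-left j∈)))
  entries-right : ∀ j → concat (take (ℓ Φ + j) (bar n Φ Ψ)) ≡ concat Φ ++ map (n +_) (concat (take j Ψ))
  entries-right j = begin
    concat (take (ℓ Φ + j) (Φ ++ Ψ↑))           ≡⟨ cong concat (take-++-+ j Φ Ψ↑) ⟩
    concat (Φ ++ take j Ψ↑)                     ≡⟨ Listₚ.concat-++ Φ _ ⟨
    concat Φ ++ concat (take j Ψ↑)              ≡⟨ cong (λ Z → concat Φ ++ concat Z) (Listₚ.take-map j Ψ) ⟩
    concat Φ ++ concat (map (map (n +_)) (take j Ψ))  ≡⟨ cong (concat Φ ++_) (Listₚ.concat-map (take j Ψ)) ⟩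
    concat Φ ++ map (n +_) (concat (take j Ψ))  ∎
  positive : ∀ j → All (1 ≤_) (concat (take j Ψ))
  positive j = All.tabulate (λ x∈ → proj₁ (∈-range⁻ (All.lookup Ψ⊆range (concat⁺ (take-⊆ j Ψ) x∈))))
  cuts-right : filter closed? (map (ℓ Φ +_) (range (ℓ Ψ))) ≡ map (ℓ Φ +_) (cuts Ψ)
  cuts-right = trans (filter-map closed? (ℓ Φ +_) (range (ℓ Ψ)))
    (cong (map (ℓ Φ +_)) (filter-cong-local (closed? ∘ (ℓ Φ +_)) (closedPrefix? Ψ) (range (ℓ Ψ))
      (λ {j} _ seg → IsInitialSegment-++-shift⁻ n (concat Φ) _ (size≡ sΦ) (positive j)
                        (subst IsInitialSegment (entries-right j) seg))
      (λ {j} _ seg → subst IsInitialSegment (sym (entries-right j))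
                       (IsInitialSegment-++-shift⁺ n (concat Φ) _ (size≡ sΦ) (proj₁ (proj₂ (proj₂ sΦ))) seg))))

atomicLengths-bar : ∀ {n k Φ Ψ} → IsSetComp n Φ → IsSetComp k Ψ →
  atomicLengths (bar n Φ Ψ) ≡ atomicLengths Φ ++ atomicLengths Ψ
atomicLengths-bar {n} {k} {Φ} {Ψ} sΦ sΨ = begin
  diffs 0 (cuts (bar n Φ Ψ))                                     ≡⟨ cong (diffs 0) (cuts-bar sΦ sΨ) ⟩
  diffs 0 (cuts Φ ++ map (ℓ Φ +_) (cuts Ψ))                      ≡⟨ diffs-++ 0 (cuts Φ) _ ⟩
  atomicLengths Φ ++ diffs (lastOr 0 (cuts Φ)) (map (ℓ Φ +_) (cuts Ψ))
    ≡⟨ cong (λ p → atomicLengths Φ ++ diffs p (map (ℓ Φ +_) (cuts Ψ))) (trans (lastOr-cuts sΦ) (sym (+-identityʳ (ℓ Φ)))) ⟩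
  atomicLengths Φ ++ diffs (ℓ Φ + 0) (map (ℓ Φ +_) (cuts Ψ))    ≡⟨ cong (atomicLengths Φ ++_) (diffs-shift (ℓ Φ) 0 (cuts Ψ)) ⟩
  atomicLengths Φ ++ atomicLengths Ψ                             ∎
  where open ≡-Reasoning

α-bar : ∀ n Φ Ψ → α (bar n Φ Ψ) ≡ α Φ ++ α Ψ
α-bar n Φ Ψ = trans (Listₚ.map-++ length Φ _) (cong (α Φ ++_) (α-map-map (n +_) Ψ))

standardizedChunks-bar : ∀ {n k Φ Ψ} → IsSetComp n Φ → IsSetComp k Ψ → ∀ X Y → ℓ X ≡ ℓ Φ →
  standardizedChunks (atomicLengths (bar n Φ Ψ)) (X ++ Y)
    ≡ standardizedChunks (atomicLengths Φ) X ++ standardizedChunks (atomicLengths Ψ) Y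
standardizedChunks-bar {n} {k} {Φ} {Ψ} sΦ sΨ X Y ℓX≡ = begin
  map st (chop (atomicLengths (bar n Φ Ψ)) (X ++ Y))     ≡⟨ cong (λ ls → map st (chop ls (X ++ Y))) (atomicLengths-bar sΦ sΨ) ⟩
  map st (chop (ls₁ ++ ls₂) (X ++ Y))                   ≡⟨ cong (map st) (chop-++ ls₁ ls₂ (X ++ Y)) ⟩
  map st (chop ls₁ (take (sum ls₁) (X ++ Y)) ++ chop ls₂ (drop (sum ls₁) (X ++ Y)))
    ≡⟨ cong₂ (λ P Q → map st (chop ls₁ P ++ chop ls₂ Q)) (take-++-length X Y |X|≡) (drop-++-length X Y |X|≡) ⟩
  map st (chop ls₁ X ++ chop ls₂ Y)                     ≡⟨ Listₚ.map-++ st (chop ls₁ X) _ ⟩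
  map st (chop ls₁ X) ++ map st (chop ls₂ Y)            ∎
  where
  open ≡-Reasoning
  ls₁ = atomicLengths Φ
  ls₂ = atomicLengths Ψ
  |X|≡ : length X ≡ sum ls₁
  |X|≡ = trans ℓX≡ (sym (sum-atomicLengths sΦ))

atomicFactors-bar : ∀ {n k Φ Ψ} → IsSetComp n Φ → IsSetComp k Ψ →
  atomicFactors (bar n Φ Ψ) ≡ atomicFactors Φ ++ atomicFactors Ψ
atomicFactors-bar {n} {Φ = Φ} {Ψ} sΦ sΨ =
  trans (standardizedChunks-bar sΦ sΨ Φ (map (map (n +_)) Ψ) refl)
        (cong (atomicFactors Φ ++_) (standardizedChunks-relabel (atomicLengths Ψ) Ψ (λ _ _ → +-monoʳ-< n)))

≤#-bar⁺ : ∀ {n k Φ Ψ P Q} → IsSetComp n Φ → IsSetComp k Ψ → Φ ≤# P → Ψ ≤# Q → bar n Φ Ψ ≤# (P ++ Q)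
≤#-bar⁺ {n} {Φ = Φ} {Ψ} {P} {Q} sΦ sΨ (αP , factorsP) (αQ , factorsQ) =
  trans (α-bar n Φ Ψ) (trans (cong₂ _++_ αP αQ) (sym (Listₚ.map-++ length P Q))) ,
  trans (atomicFactors-bar sΦ sΨ)
        (trans (cong₂ _++_ factorsP factorsQ) (sym (standardizedChunks-bar sΦ sΨ P Q (sym (ℓ-cong-α αP)))))

≤#-bar⁻ : ∀ {n k Φ Ψ Θ} → IsSetComp n Φ → IsSetComp k Ψ → bar n Φ Ψ ≤# Θ →
  Φ ≤# take (ℓ Φ) Θ × Ψ ≤# drop (ℓ Φ) Θ
≤#-bar⁻ {n} {Φ = Φ} {Ψ} {Θ} sΦ sΨ (α≡ , factors≡) = (αP , proj₁ factors-split) , (αQ , proj₂ factors-split)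
  where
  l = ℓ Φ
  αΘ : α Φ ++ α Ψ ≡ α Θ
  αΘ = trans (sym (α-bar n Φ Ψ)) α≡
  |αΦ| : length (α Φ) ≡ l
  |αΦ| = Listₚ.length-map length Φ
  αP : α Φ ≡ α (take l Θ)
  αP = trans (sym (take-++-length (α Φ) (α Ψ) |αΦ|)) (trans (cong (take l) αΘ) (Listₚ.take-map l Θ))
  αQ : α Ψ ≡ α (drop l Θ)
  αQ = trans (sym (drop-++-length (α Φ) (α Ψ) |αΦ|)) (trans (cong (drop l) αΘ) (Listₚ.drop-map l Θ))
  length-standardizedChunks : ∀ X → length (standardizedChunks (atomicLengths Φ) X) ≡ length (atomicLengths Φ)
  length-standardizedChunks X = trans (Listₚ.length-map st (chop (atomicLengths Φ) X)) (length-chop (atomicLengths Φ) X)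
  factors-split = ++-injective _ _ _ _
    (trans (length-standardizedChunks Φ) (sym (length-standardizedChunks (take l Θ))))
    (begin
      atomicFactors Φ ++ atomicFactors Ψ                                  ≡⟨ atomicFactors-bar sΦ sΨ ⟨
      atomicFactors (bar n Φ Ψ)                                           ≡⟨ factors≡ ⟩
      standardizedChunks (atomicLengths (bar n Φ Ψ)) Θ                    ≡⟨ cong (standardizedChunks _) (Listₚ.take++drop≡id l Θ) ⟨
      standardizedChunks (atomicLengths (bar n Φ Ψ)) (take l Θ ++ drop l Θ) ≡⟨ standardizedChunks-bar sΦ sΨ _ _ (sym (ℓ-cong-α αP)) ⟩
      standardizedChunks (atomicLengths Φ) (take l Θ) ++ standardizedChunks (atomicLengths Ψ) (drop l Θ) ∎)
    where open ≡-Reasoning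

-- Relabelling a set composition of [m] by an m-element set, and back

st-setComp : ∀ {m X} → IsSetComp m X → st X ≡ X
st-setComp {m} {X} sX@(_ , _ , ⊆range , range⊆) = trans (map-map-cong-local X rank-self) (map-map-id X)
  where
  rank-self : ∀ {x} → x ∈ concat X → rank (concat X) x ≡ x
  rank-self x∈ with ∈-range-suc⁻ (All.lookup ⊆range x∈)
  ... | i , refl , i<m = begin
    rank (concat X) (suc i)        ≡⟨ unique-⊆⊇⇒filter-length≡ (_≤? suc i) (entries-unique (IsSetComp⇒IsPartial sX))
                                        (range-unique m) (All.lookup ⊆range) (All.lookup range⊆) ⟩
    rank (range m) (suc i)         ≡⟨ cong (rank (range m)) (nth-range m i i<m) ⟨
    rank (range m) (nth (range m) i) ≡⟨ rank-nth (range-increasing m) i (subst (i <_) (sym (length-range m)) i<m) ⟩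
    suc i                          ∎
    where open ≡-Reasoning

module Relabel {m X} (sX : IsSetComp m X) {S} (incS : Increasing S) (|S|≡m : length S ≡ m) where

  private
    X⊆range = proj₁ (proj₂ (proj₂ sX))
    range⊆X = proj₂ (proj₂ (proj₂ sX))
    f = λ i → nth S (i ∸ 1)

  strictlyMonotone : StrictlyMonotoneOn (concat X) f
  strictlyMonotone = strictlyMonotoneOn-⊆ (All.lookup X⊆range) on-range
    where
    on-range : StrictlyMonotoneOn (range m) f
    on-range x∈ y∈ x<y with ∈-range-suc⁻ x∈ | ∈-range-suc⁻ y∈
    ... | i , refl , _ | j , refl , j<m = nth-strictMono incS (≤-pred x<y) (subst (j <_) (sym |S|≡m) j<m)

  entries : concat (X ↑ S) ≡ map f (concat X)
  entries = Listₚ.concat-map X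

  isPartial : IsPartial (X ↑ S)
  isPartial = IsPartial-relabel (IsSetComp⇒IsPartial sX) strictlyMonotone

  entries⊆ : concat (X ↑ S) ⊆ S
  entries⊆ z∈ with ∈-map⁻ f (subst (_ ∈_) entries z∈)
  ... | i , i∈ , refl with ∈-range-suc⁻ (All.lookup X⊆range i∈)
  ... | j , refl , j<m = nth-∈ S j (subst (j <_) (sym |S|≡m) j<m)

  ⊆entries : S ⊆ concat (X ↑ S)
  ⊆entries z∈ with ∈⇒nth z∈
  ... | j , j< , refl =
    subst (_ ∈_) (sym entries) (∈-map⁺ f (All.lookup range⊆X (∈-range⁺ (s≤s z≤n) (subst (j <_) |S|≡m j<))))

  ≤#-↑ : ∀ {Φ} → Φ ≤# X → Φ ≤# (X ↑ S)
  ≤#-↑ = ≤#-relabel strictlyMonotone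

  st-↑ : st (X ↑ S) ≡ X
  st-↑ = trans (st-relabel strictlyMonotone) (st-setComp sX)

module Standardize {P} (pP : IsPartial P) {S} (incS : Increasing S) (S⊆ : S ⊆ concat P) (⊆S : concat P ⊆ S) where

  private
    rank-S : ∀ x → rank (concat P) x ≡ rank S x
    rank-S x = unique-⊆⊇⇒filter-length≡ (_≤? x) (entries-unique pP) (Increasing⇒Unique incS) ⊆S S⊆

    rank-∈ₚ : ∀ {x} → x ∈ concat P → Σ ℕ (λ i → i < length S × nth S i ≡ x × rank (concat P) x ≡ suc i)
    rank-∈ₚ x∈ with rank-∈ incS (⊆S x∈)
    ... | i , i< , eq , rank≡ = i , i< , eq , trans (rank-S _) rank≡

  strictlyMonotone : StrictlyMonotoneOn (concat P) (rank (concat P))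
  strictlyMonotone x∈ y∈ x<y with rank-∈ₚ x∈ | rank-∈ₚ y∈
  ... | i , i< , refl , rx | j , j< , refl , ry with <-cmp i j
  ... | tri< i<j _ _ = subst₂ _<_ (sym rx) (sym ry) (s≤s i<j)
  ... | tri≈ _ refl _ = ⊥-elim (<-irrefl refl x<y)
  ... | tri> _ _ j<i = ⊥-elim (<-asym x<y (nth-strictMono incS j<i i<))

  isSetComp : IsSetComp (length S) (st P)
  isSetComp = proj₁ partial , proj₂ partial , All.tabulate (bounded ∘ subst (_ ∈_) entries) , All.tabulate covered
    where
    partial = IsPartial-relabel pP strictlyMonotone
    entries : concat (st P) ≡ map (rank (concat P)) (concat P)
    entries = Listₚ.concat-map P
    bounded : ∀ {z} → z ∈ map (rank (concat P)) (concat P) → z ∈ range (length S)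
    bounded z∈ with ∈-map⁻ (rank (concat P)) z∈
    ... | x , x∈ , refl with rank-∈ₚ x∈
    ... | i , i< , _ , rank≡ = subst (_∈ range (length S)) (sym rank≡) (∈-range⁺ (s≤s z≤n) i<)
    covered : ∀ {j} → j ∈ range (length S) → j ∈ concat (st P)
    covered j∈ with ∈-range-suc⁻ j∈
    ... | i , refl , i< = subst (_ ∈_) (sym entries)
      (subst (_∈ map (rank (concat P)) (concat P)) (trans (rank-S _) (rank-nth incS i i<)) (∈-map⁺ _ (S⊆ (nth-∈ S i i<))))

  st-↑ : st P ↑ S ≡ P
  st-↑ = trans (map-map-∘ (rank (concat P)) (λ i → nth S (i ∸ 1)) P) (trans (map-map-cong-local P unrank) (map-map-id P))
    where
    unrank : ∀ {x} → x ∈ concat P → nth S (rank (concat P) x ∸ 1) ≡ x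
    unrank x∈ with rank-∈ₚ x∈
    ... | i , _ , nth≡ , rank≡ = trans (cong (λ r → nth S (r ∸ 1)) rank≡) nth≡

  ≤#-st : ∀ {Φ} → Φ ≤# P → Φ ≤# st P
  ≤#-st = ≤#-relabel strictlyMonotone

indicator : List SetComp → Elem
indicator = map (1ℚ ,_)

coeff-indicator-∉ : ∀ {Θ} xs → Θ ∉ xs → coeff (indicator xs) Θ ≡ 0ℚ
coeff-indicator-∉ [] _ = refl
coeff-indicator-∉ {Θ} (y ∷ ys) Θ∉ with y ≟SC Θ
... | yes refl = ⊥-elim (Θ∉ (here refl))
... | no _ = coeff-indicator-∉ ys (Θ∉ ∘ there)

coeff-indicator-∈ : ∀ {Θ} xs → Unique xs → Θ ∈ xs → coeff (indicator xs) Θ ≡ 1ℚ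
coeff-indicator-∈ {Θ} (y ∷ ys) (y∉ ∷ u) Θ∈ with y ≟SC Θ | Θ∈
... | yes refl | _ = trans (cong (1ℚ +ℚ_) (coeff-indicator-∉ ys (Allₚ.All¬⇒¬Any y∉))) (ℚₚ.+-identityʳ 1ℚ)
... | no y≢Θ | here refl = ⊥-elim (y≢Θ refl)
... | no _ | there Θ∈ys = coeff-indicator-∈ ys u Θ∈ys

indicator-≈ : ∀ {xs ys} → Unique xs → Unique ys → xs ⊆ ys → ys ⊆ xs → indicator xs ≈ indicator ys
indicator-≈ {xs} {ys} ux uy xs⊆ ys⊆ Θ with Θ ∈SC? xs
... | yes Θ∈ = trans (coeff-indicator-∈ xs ux Θ∈) (sym (coeff-indicator-∈ ys uy (xs⊆ Θ∈)))
... | no Θ∉ = trans (coeff-indicator-∉ xs Θ∉) (sym (coeff-indicator-∉ ys (Θ∉ ∘ ys⊆)))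

productTerms : List SetComp → List SetComp → List SetComp
productTerms As Bs = concatMap (λ Φ′ → concatMap (mulW Φ′) Bs) As

indicator-⋆ : ∀ As Bs → (indicator As ⋆ indicator Bs) ≡ indicator (productTerms As Bs)
indicator-⋆ [] Bs = refl
indicator-⋆ (A ∷ As) Bs = trans (cong₂ _++_ (row Bs) (indicator-⋆ As Bs)) (sym (Listₚ.map-++ (1ℚ ,_) (concatMap (mulW A) Bs) _))
  where
  row : ∀ Bs → concatMap (λ q → map (λ Θ → (1ℚ *ℚ proj₁ q) , Θ) (mulW A (proj₂ q))) (indicator Bs)
               ≡ indicator (concatMap (mulW A) Bs)
  row [] = refl
  row (B ∷ Bs) = trans (cong (indicator (mulW A B) ++_) (row Bs)) (sym (Listₚ.map-++ (1ℚ ,_) (mulW A B) _))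

-- The expansion of V_Φ V_Ψ

-- Opaque, so that solving Φ′ ∈ above ?n ?Φ does not unfold the enumeration allSetComps.
opaque
  above : ℕ → SetComp → List SetComp
  above n Φ = filter (Φ ≤#?_) (allSetComps n)

  V≡indicator-above : ∀ n Φ → V n Φ ≡ indicator (above n Φ)
  V≡indicator-above n Φ = refl

  ∈-above⁻ : ∀ {n Φ Φ′} → Φ′ ∈ above n Φ → IsSetComp n Φ′ × Φ ≤# Φ′
  ∈-above⁻ {n} {Φ} m with ∈-filter⁻ (Φ ≤#?_) {xs = allSetComps n} m
  ... | Φ′∈ , Φ≤#Φ′ = ∈-allSetComps⁻ Φ′∈ , Φ≤#Φ′

  ∈-above⁺ : ∀ {n Φ Φ′} → IsSetComp n Φ′ → Φ ≤# Φ′ → Φ′ ∈ above n Φ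
  ∈-above⁺ {Φ = Φ} sΦ′ Φ≤#Φ′ = ∈-filter⁺ (Φ ≤#?_) (∈-allSetComps⁺ sΦ′) Φ≤#Φ′

  above-unique : ∀ n Φ → Unique (above n Φ)
  above-unique n Φ = Uniqueₚ.filter⁺ (Φ ≤#?_) (allSetComps-unique n)

module Shuffle (n k : ℕ) where

  complement : List ℕ → List ℕ
  complement S = filter (λ x → ¬? (x ∈? S)) (range (n + k))

  ∈-complement⁻ : ∀ {S x} → x ∈ complement S → x ∈ range (n + k) × x ∉ S
  ∈-complement⁻ {S} = ∈-filter⁻ (λ x → ¬? (x ∈? S)) {xs = range (n + k)}

  shuffle : SetComp → SetComp → List ℕ → SetComp
  shuffle Φ′ Ψ′ S = (Φ′ ↑ S) ++ (Ψ′ ↑ complement S)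

  mulW-shuffle : ∀ {Φ′ Ψ′} → IsSetComp n Φ′ → IsSetComp k Ψ′ →
    mulW Φ′ Ψ′ ≡ map (shuffle Φ′ Ψ′) (choose n (range (n + k)))
  mulW-shuffle {Φ′} {Ψ′} sΦ′ sΨ′ = cong₂ mulW-with-sizes (size≡ sΦ′) (size≡ sΨ′)
    where
    mulW-with-sizes : ℕ → ℕ → List SetComp
    mulW-with-sizes a b =
      map (λ S → (Φ′ ↑ S) ++ (Ψ′ ↑ filter (λ x → ¬? (x ∈? S)) (range (a + b)))) (choose a (range (a + b)))

  record Chosen (S : List ℕ) : Set where
    field
      sublist : S ∈ sublists (range (n + k))
      cardinality : length S ≡ n
      increasing : Increasing S
      complement-increasing : Increasing (complement S)
      complement-size : length (complement S) ≡ k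

  chosen : ∀ {S} → S ∈ choose n (range (n + k)) → Chosen S
  chosen {S} S∈ with ∈-filter⁻ (λ S → length S ≟ n) {xs = sublists (range (n + k))} S∈
  ... | S∈sub , |S|≡n = record
    { sublist = S∈sub
    ; cardinality = |S|≡n
    ; increasing = sublists-increasing (range-increasing (n + k)) S∈sub
    ; complement-increasing = AllPairsₚ.filter⁺ _ (range-increasing (n + k))
    ; complement-size = +-cancelˡ-≡ n _ _ (begin
        n + length (complement S)                                   ≡⟨ cong (_+ length (complement S)) |filter|≡n ⟨
        length (filter (_∈? S) R) + length (complement S)           ≡⟨ length-filter-+-complement (_∈? S) R ⟩
        length R                                                    ≡⟨ length-range (n + k) ⟩
        n + k                                                       ∎)
    }
    where
    open ≡-Reasoning
    R = range (n + k)
    |filter|≡n : length (filter (_∈? S) R) ≡ n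
    |filter|≡n = trans (cong length (filter-∈-sublists (range-unique (n + k)) S∈sub)) |S|≡n

  shuffle-isSetComp : ∀ {Φ′ Ψ′ S} → IsSetComp n Φ′ → IsSetComp k Ψ′ → S ∈ choose n (range (n + k)) →
    IsSetComp (n + k) (shuffle Φ′ Ψ′ S)
  shuffle-isSetComp {Φ′} {Ψ′} {S} sΦ′ sΨ′ S∈ =
    Allₚ.++⁺ (proj₁ L.isPartial) (proj₁ R.isPartial) ,
    AllPairsₚ.++⁺ (proj₂ L.isPartial) (proj₂ R.isPartial) cross ,
    All.tabulate (bounded ∘ subst (_ ∈_) entries) ,
    All.tabulate (subst (_ ∈_) (sym entries) ∘ covered)
    where
    c = chosen S∈
    module L = Relabel sΦ′ (Chosen.increasing c) (Chosen.cardinality c)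
    module R = Relabel sΨ′ (Chosen.complement-increasing c) (Chosen.complement-size c)
    entries : concat (shuffle Φ′ Ψ′ S) ≡ concat (Φ′ ↑ S) ++ concat (Ψ′ ↑ complement S)
    entries = sym (Listₚ.concat-++ (Φ′ ↑ S) _)
    cross : All (λ A → All (Disjoint A) (Ψ′ ↑ complement S)) (Φ′ ↑ S)
    cross = All.tabulate λ A∈ → All.tabulate λ B∈ → All.tabulate λ a∈ a∈B →
      proj₂ (∈-complement⁻ (R.entries⊆ (∈-concat⁺′ a∈B B∈))) (L.entries⊆ (∈-concat⁺′ a∈ A∈))
    bounded : ∀ {z} → z ∈ concat (Φ′ ↑ S) ++ concat (Ψ′ ↑ complement S) → z ∈ range (n + k)
    bounded z∈ with ∈-++⁻ (concat (Φ′ ↑ S)) z∈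
    ... | inj₁ z∈L = ∈-sublists⁻ (Chosen.sublist c) (L.entries⊆ z∈L)
    ... | inj₂ z∈R = proj₁ (∈-complement⁻ (R.entries⊆ z∈R))
    covered : ∀ {x} → x ∈ range (n + k) → x ∈ concat (Φ′ ↑ S) ++ concat (Ψ′ ↑ complement S)
    covered {x} x∈ with x ∈? S
    ... | yes x∈S = ∈-++⁺ˡ (L.⊆entries x∈S)
    ... | no x∉S = ∈-++⁺ʳ (concat (Φ′ ↑ S)) (R.⊆entries (∈-filter⁺ (λ x → ¬? (x ∈? S)) x∈ x∉S))

  ≤#-shuffle : ∀ {Φ Ψ Φ′ Ψ′ S} → IsSetComp n Φ → IsSetComp k Ψ → IsSetComp n Φ′ → IsSetComp k Ψ′ →
    S ∈ choose n (range (n + k)) → Φ ≤# Φ′ → Ψ ≤# Ψ′ → bar n Φ Ψ ≤# shuffle Φ′ Ψ′ S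
  ≤#-shuffle sΦ sΨ sΦ′ sΨ′ S∈ Φ≤#Φ′ Ψ≤#Ψ′ =
    ≤#-bar⁺ sΦ sΨ (Relabel.≤#-↑ sΦ′ (Chosen.increasing c) (Chosen.cardinality c) Φ≤#Φ′)
                  (Relabel.≤#-↑ sΨ′ (Chosen.complement-increasing c) (Chosen.complement-size c) Ψ≤#Ψ′)
    where c = chosen S∈

  ↑-entries-determine : ∀ {Φ′ S} → IsSetComp n Φ′ → S ∈ choose n (range (n + k)) →
    filter (_∈? concat (Φ′ ↑ S)) (range (n + k)) ≡ S
  ↑-entries-determine {Φ′} {S} sΦ′ S∈ =
    trans (filter-cong-local (_∈? concat (Φ′ ↑ S)) (_∈? S) (range (n + k)) (λ _ → L.entries⊆) (λ _ → L.⊆entries))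
          (filter-∈-sublists (range-unique (n + k)) (Chosen.sublist c))
    where
    c = chosen S∈
    module L = Relabel sΦ′ (Chosen.increasing c) (Chosen.cardinality c)

  shuffle-injective : ∀ {Φ₁ Φ₂ Ψ₁ Ψ₂ S₁ S₂} →
    IsSetComp n Φ₁ → IsSetComp n Φ₂ → IsSetComp k Ψ₁ → IsSetComp k Ψ₂ → ℓ Φ₁ ≡ ℓ Φ₂ →
    S₁ ∈ choose n (range (n + k)) → S₂ ∈ choose n (range (n + k)) →
    shuffle Φ₁ Ψ₁ S₁ ≡ shuffle Φ₂ Ψ₂ S₂ → Φ₁ ≡ Φ₂ × Ψ₁ ≡ Ψ₂ × S₁ ≡ S₂
  shuffle-injective {Φ₁} {Φ₂} {Ψ₁} {Ψ₂} {S₁} {S₂} sΦ₁ sΦ₂ sΨ₁ sΨ₂ ℓ≡ S₁∈ S₂∈ eq =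
    trans (sym L₁.st-↑) (trans (cong st left≡) L₂.st-↑) ,
    trans (sym R₁.st-↑) (trans (cong st right≡) R₂.st-↑) ,
    trans (sym (↑-entries-determine sΦ₁ S₁∈))
          (trans (cong (λ X → filter (_∈? concat X) (range (n + k))) left≡) (↑-entries-determine sΦ₂ S₂∈))
    where
    c₁ = chosen S₁∈
    c₂ = chosen S₂∈
    module L₁ = Relabel sΦ₁ (Chosen.increasing c₁) (Chosen.cardinality c₁)
    module L₂ = Relabel sΦ₂ (Chosen.increasing c₂) (Chosen.cardinality c₂)
    module R₁ = Relabel sΨ₁ (Chosen.complement-increasing c₁) (Chosen.complement-size c₁)
    module R₂ = Relabel sΨ₂ (Chosen.complement-increasing c₂) (Chosen.complement-size c₂)
    halves = ++-injective (Φ₁ ↑ S₁) _ (Φ₂ ↑ S₂) _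
               (trans (Listₚ.length-map _ Φ₁) (trans ℓ≡ (sym (Listₚ.length-map _ Φ₂)))) eq
    left≡ = proj₁ halves
    right≡ = proj₂ halves

  module Split {Θ} (sΘ : IsSetComp (n + k) Θ) (l : ℕ) where

    P = take l Θ
    Q = drop l Θ
    S = filter (_∈? concat P) (range (n + k))

    private
      pΘ = IsSetComp⇒IsPartial sΘ
      Θ⊆range = proj₁ (proj₂ (proj₂ sΘ))
      range⊆Θ = proj₂ (proj₂ (proj₂ sΘ))
      entries : concat Θ ≡ concat P ++ concat Q
      entries = trans (cong concat (sym (Listₚ.take++drop≡id l Θ))) (sym (Listₚ.concat-++ P Q))
      P⊆range : concat P ⊆ range (n + k)
      P⊆range = All.lookup Θ⊆range ∘ subst (_ ∈_) (sym entries) ∘ ∈-++⁺ˡ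

    pP : IsPartial P
    pP = Allₚ.take⁺ l (proj₁ pΘ) , AllPairsₚ.take⁺ l (proj₂ pΘ)

    pQ : IsPartial Q
    pQ = Allₚ.drop⁺ l (proj₁ pΘ) , AllPairsₚ.drop⁺ l (proj₂ pΘ)

    S-increasing : Increasing S
    S-increasing = AllPairsₚ.filter⁺ _ (range-increasing (n + k))

    complement-increasing : Increasing (complement S)
    complement-increasing = AllPairsₚ.filter⁺ _ (range-increasing (n + k))

    S⊆ : S ⊆ concat P
    S⊆ x∈ = proj₂ (∈-filter⁻ (_∈? concat P) {xs = range (n + k)} x∈)

    ⊆S : concat P ⊆ S
    ⊆S x∈ = ∈-filter⁺ (_∈? concat P) (P⊆range x∈) x∈

    complement⊆ : complement S ⊆ concat Q
    complement⊆ x∈ with ∈-complement⁻ x∈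
    ... | x∈range , x∉S with ∈-++⁻ (concat P) (subst (_ ∈_) entries (All.lookup range⊆Θ x∈range))
    ... | inj₁ x∈P = ⊥-elim (x∉S (⊆S x∈P))
    ... | inj₂ x∈Q = x∈Q

    ⊆complement : concat Q ⊆ complement S
    ⊆complement x∈ =
      ∈-filter⁺ (λ x → ¬? (x ∈? S)) (All.lookup Θ⊆range (subst (_ ∈_) (sym entries) (∈-++⁺ʳ (concat P) x∈)))
        (λ x∈S → Unique-++⇒disjoint (subst Unique entries (entries-unique pΘ)) (S⊆ x∈S) x∈)

    module StP = Standardize pP S-increasing S⊆ ⊆S
    module StQ = Standardize pQ complement-increasing complement⊆ ⊆complement

    shuffle-st : shuffle (st P) (st Q) S ≡ Θ
    shuffle-st = trans (cong₂ _++_ StP.st-↑ StQ.st-↑) (Listₚ.take++drop≡id l Θ)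

    |S|≡size : length S ≡ size P
    |S|≡size = unique-⊆⊇⇒length≡ (Increasing⇒Unique S-increasing) (entries-unique pP) S⊆ ⊆S

    |complement|≡size : length (complement S) ≡ size Q
    |complement|≡size =
      unique-⊆⊇⇒length≡ (Increasing⇒Unique complement-increasing) (entries-unique pQ) complement⊆ ⊆complement

    S∈choose : length S ≡ n → S ∈ choose n (range (n + k))
    S∈choose = ∈-filter⁺ (λ S → length S ≟ n) (∈-sublists⁺ (range-increasing (n + k)) S-increasing (P⊆range ∘ S⊆))

  ∈-mulW⁻ : ∀ {Φ′ Ψ′ Θ} → IsSetComp n Φ′ → IsSetComp k Ψ′ → Θ ∈ mulW Φ′ Ψ′ →
    Σ (List ℕ) (λ S → S ∈ choose n (range (n + k)) × shuffle Φ′ Ψ′ S ≡ Θ)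
  ∈-mulW⁻ sΦ′ sΨ′ Θ∈ with ∈-map⁻ _ (subst (_ ∈_) (mulW-shuffle sΦ′ sΨ′) Θ∈)
  ... | S , S∈ , refl = S , S∈ , refl

  record ShuffleOf (Φ Ψ Θ : SetComp) : Set where
    field
      {left right} : SetComp
      {positions} : List ℕ
      left∈ : left ∈ above n Φ
      right∈ : right ∈ above k Ψ
      positions∈ : positions ∈ choose n (range (n + k))
      shuffle≡ : shuffle left right positions ≡ Θ

  ∈-productTerms⁻ : ∀ {Φ Ψ Θ} → Θ ∈ productTerms (above n Φ) (above k Ψ) → ShuffleOf Φ Ψ Θ
  ∈-productTerms⁻ {Φ} {Ψ} Θ∈ with find (∈-concatMap⁻ (λ Φ′ → concatMap (mulW Φ′) (above k Ψ)) {xs = above n Φ} Θ∈)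
  ... | Φ′ , Φ′∈ , Θ∈′ with find (∈-concatMap⁻ (mulW Φ′) {xs = above k Ψ} Θ∈′)
  ... | Ψ′ , Ψ′∈ , Θ∈mulW with ∈-mulW⁻ (proj₁ (∈-above⁻ Φ′∈)) (proj₁ (∈-above⁻ Ψ′∈)) Θ∈mulW
  ... | S , S∈ , eq = record { left∈ = Φ′∈ ; right∈ = Ψ′∈ ; positions∈ = S∈ ; shuffle≡ = eq }

  ∈-productTerms⁺ : ∀ {Φ Ψ Θ} → ShuffleOf Φ Ψ Θ → Θ ∈ productTerms (above n Φ) (above k Ψ)
  ∈-productTerms⁺ {Φ} {Ψ} {Θ}
    record { left = Φ′ ; right = Ψ′ ; left∈ = Φ′∈ ; right∈ = Ψ′∈ ; positions∈ = S∈ ; shuffle≡ = refl } =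
    ∈-concatMap⁺ (λ Φ″ → concatMap (mulW Φ″) (above k Ψ)) (Any.map (λ { refl → Θ∈row }) Φ′∈)
    where
    Θ∈row : Θ ∈ concatMap (mulW Φ′) (above k Ψ)
    Θ∈row = ∈-concatMap⁺ (mulW Φ′) (Any.map (λ { refl →
      subst (Θ ∈_) (sym (mulW-shuffle (proj₁ (∈-above⁻ Φ′∈)) (proj₁ (∈-above⁻ Ψ′∈)))) (∈-map⁺ _ S∈) }) Ψ′∈)

  module _ {Φ Ψ} (sΦ : IsSetComp n Φ) (sΨ : IsSetComp k Ψ) where

    productTerms⊆above : productTerms (above n Φ) (above k Ψ) ⊆ above (n + k) (bar n Φ Ψ)
    productTerms⊆above Θ∈ =
      subst (_∈ above (n + k) (bar n Φ Ψ)) shuffle≡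
        (∈-above⁺ (shuffle-isSetComp sΦ′ sΨ′ positions∈)
                  (≤#-shuffle sΦ sΨ sΦ′ sΨ′ positions∈ (proj₂ (∈-above⁻ left∈)) (proj₂ (∈-above⁻ right∈))))
      where
      open ShuffleOf (∈-productTerms⁻ Θ∈)
      sΦ′ = proj₁ (∈-above⁻ left∈)
      sΨ′ = proj₁ (∈-above⁻ right∈)

    above⊆productTerms : above (n + k) (bar n Φ Ψ) ⊆ productTerms (above n Φ) (above k Ψ)
    above⊆productTerms {Θ} Θ∈ = ∈-productTerms⁺ (record
      { left∈ = ∈-above⁺ sP (StP.≤#-st (proj₁ halves))
      ; right∈ = ∈-above⁺ sQ (StQ.≤#-st (proj₂ halves))
      ; positions∈ = S∈choose |S|≡n
      ; shuffle≡ = shuffle-st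
      })
      where
      sΘ = proj₁ (∈-above⁻ Θ∈)
      halves = ≤#-bar⁻ sΦ sΨ (proj₂ (∈-above⁻ Θ∈))
      open Split sΘ (ℓ Φ)
      |S|≡n : length S ≡ n
      |S|≡n = trans |S|≡size (trans (size-cong-α (sym (proj₁ (proj₁ halves)))) (size≡ sΦ))
      |complement|≡k : length (complement S) ≡ k
      |complement|≡k = trans |complement|≡size (trans (size-cong-α (sym (proj₁ (proj₂ halves)))) (size≡ sΨ))
      sP : IsSetComp n (st P)
      sP = subst (λ m → IsSetComp m (st P)) |S|≡n StP.isSetComp
      sQ : IsSetComp k (st Q)
      sQ = subst (λ m → IsSetComp m (st Q)) |complement|≡k StQ.isSetComp

    mulW-injective : ∀ {Φ₁ Φ₂ Ψ₁ Ψ₂ Θ} → Φ₁ ∈ above n Φ → Φ₂ ∈ above n Φ → Ψ₁ ∈ above k Ψ → Ψ₂ ∈ above k Ψ →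
      Θ ∈ mulW Φ₁ Ψ₁ → Θ ∈ mulW Φ₂ Ψ₂ → Φ₁ ≡ Φ₂ × Ψ₁ ≡ Ψ₂
    mulW-injective Φ₁∈ Φ₂∈ Ψ₁∈ Ψ₂∈ Θ∈₁ Θ∈₂ = proj₁ same , proj₁ (proj₂ same)
      where
      sΦ₁ = proj₁ (∈-above⁻ Φ₁∈)
      sΦ₂ = proj₁ (∈-above⁻ Φ₂∈)
      sΨ₁ = proj₁ (∈-above⁻ Ψ₁∈)
      sΨ₂ = proj₁ (∈-above⁻ Ψ₂∈)
      ℓ≡ : ∀ {Φ′} → Φ′ ∈ above n Φ → ℓ Φ′ ≡ ℓ Φ
      ℓ≡ Φ′∈ = sym (ℓ-cong-α (proj₁ (proj₂ (∈-above⁻ Φ′∈))))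
      d₁ = ∈-mulW⁻ sΦ₁ sΨ₁ Θ∈₁
      d₂ = ∈-mulW⁻ sΦ₂ sΨ₂ Θ∈₂
      same = shuffle-injective sΦ₁ sΦ₂ sΨ₁ sΨ₂ (trans (ℓ≡ Φ₁∈) (sym (ℓ≡ Φ₂∈))) (proj₁ (proj₂ d₁)) (proj₁ (proj₂ d₂))
                               (trans (proj₂ (proj₂ d₁)) (sym (proj₂ (proj₂ d₂))))

    productTerms-unique : Unique (productTerms (above n Φ) (above k Ψ))
    productTerms-unique =
      unique-concatMap (λ Φ′ → concatMap (mulW Φ′) (above k Ψ)) (above-unique n Φ) row-unique same-left
      where
      row-unique : ∀ {Φ′} → Φ′ ∈ above n Φ → Unique (concatMap (mulW Φ′) (above k Ψ))
      row-unique {Φ′} Φ′∈ =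
        unique-concatMap (mulW Φ′) (above-unique k Ψ) mulW-unique
          (λ Ψ₁∈ Ψ₂∈ Θ∈₁ Θ∈₂ → proj₂ (mulW-injective Φ′∈ Φ′∈ Ψ₁∈ Ψ₂∈ Θ∈₁ Θ∈₂))
        where
        sΦ′ = proj₁ (∈-above⁻ Φ′∈)
        mulW-unique : ∀ {Ψ′} → Ψ′ ∈ above k Ψ → Unique (mulW Φ′ Ψ′)
        mulW-unique {Ψ′} Ψ′∈ = subst Unique (sym (mulW-shuffle sΦ′ sΨ′))
          (unique-map-local (shuffle Φ′ Ψ′) (Uniqueₚ.filter⁺ _ (sublists-unique (range-unique (n + k))))
            (λ S₁∈ S₂∈ eq → proj₂ (proj₂ (shuffle-injective sΦ′ sΦ′ sΨ′ sΨ′ refl S₁∈ S₂∈ eq))))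
          where sΨ′ = proj₁ (∈-above⁻ Ψ′∈)
      same-left : ∀ {Φ₁ Φ₂ Θ} → Φ₁ ∈ above n Φ → Φ₂ ∈ above n Φ →
        Θ ∈ concatMap (mulW Φ₁) (above k Ψ) → Θ ∈ concatMap (mulW Φ₂) (above k Ψ) → Φ₁ ≡ Φ₂
      same-left Φ₁∈ Φ₂∈ Θ∈₁ Θ∈₂
        with find (∈-concatMap⁻ (mulW _) {xs = above k Ψ} Θ∈₁) | find (∈-concatMap⁻ (mulW _) {xs = above k Ψ} Θ∈₂)
      ... | _ , Ψ₁∈ , Θ∈mulW₁ | _ , Ψ₂∈ , Θ∈mulW₂ =
        proj₁ (mulW-injective Φ₁∈ Φ₂∈ Ψ₁∈ Ψ₂∈ Θ∈mulW₁ Θ∈mulW₂)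

mainTheorem14 : (n k : ℕ) (Φ Ψ : SetComp) → IsSetComp n Φ → IsSetComp k Ψ →
                  (V n Φ ⋆ V k Ψ) ≈ V (n + k) (bar n Φ Ψ)
mainTheorem14 n k Φ Ψ sΦ sΨ Θ = begin
  coeff (V n Φ ⋆ V k Ψ) Θ
    ≡⟨ cong (λ x → coeff (x ⋆ V k Ψ) Θ) (V≡indicator-above n Φ) ⟩
  coeff (indicator (above n Φ) ⋆ V k Ψ) Θ
    ≡⟨ cong (λ x → coeff (indicator (above n Φ) ⋆ x) Θ) (V≡indicator-above k Ψ) ⟩
  coeff (indicator (above n Φ) ⋆ indicator (above k Ψ)) Θ
    ≡⟨ cong (λ x → coeff x Θ) (indicator-⋆ (above n Φ) (above k Ψ)) ⟩
  coeff (indicator (productTerms (above n Φ) (above k Ψ))) Θ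
    ≡⟨ indicator-≈ (productTerms-unique sΦ sΨ) (above-unique (n + k) (bar n Φ Ψ))
                   (productTerms⊆above sΦ sΨ) (above⊆productTerms sΦ sΨ) Θ ⟩
  coeff (indicator (above (n + k) (bar n Φ Ψ))) Θ
    ≡⟨ cong (λ x → coeff x Θ) (V≡indicator-above (n + k) (bar n Φ Ψ)) ⟨
  coeff (V (n + k) (bar n Φ Ψ)) Θ ∎
  where
  open ≡-Reasoning
  open Shuffle n k
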